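{- Let $v_1,\dots,v_t$ be fixed possible oracle responses (each an element of $[n]$, a pair in $[n]\times[n]$, or $\emptyset$) satisfying events $\mathcal E_T$ and $\mathcal E_F$, and let $C_1,\dots,C_\alpha$ be the components they form. Then $$\Pr_{\mathbf A}[\boldsymbol{\mathcal E}_{C,\text{yes}}]\le(1+o(1))\Pr_{\mathbf A}[\boldsymbol{\mathcal E}_{C,\text{no}}],$$ where $\mathbf A\subset[n]$ is a uniformly random subset of size $n/2$ and $o(1)$ is as $n\to\infty$.
   Context: Let $G_o$ be the graph whose vertices are all vertices appearing in $v_1,\dots,v_t$ and whose edges are those responses $v_i$ that are edges; $C_1,\dots,C_\alpha$ are its connected components. Event $\mathcal E_T$: every component is a tree with at most $\log n$ vertices. Event $\mathcal E_F$: at most $n/\log^4 n$ of the $v_i$ are not $\emptyset$. For each $i$, root $C_i$ at its minimum vertex $u_i$ and let $C_i(\text{odd})$, $C_i(\text{even})$ be the vertices at odd, resp. even, depth layers (the root being in layer $1$). Event $\boldsymbol{\mathcal E}_{C,\text{yes}}$: for every $i$, $C_i\subseteq\mathbf A$ or $C_i\subseteq\overline{\mathbf A}$. Event $\boldsymbol{\mathcal E}_{C,\text{no}}$: for every $i$, either $C_i(\text{odd})\subseteq\mathbf A$ and $C_i(\text{even})\subseteq\overline{\mathbf A}$, or $C_i(\text{odd})\subseteq\overline{\mathbf A}$ and $C_i(\text{even})\subseteq\mathbf A$. -}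

module Defs where

open import Data.Nat using (ℕ; zero; suc; _+_; _*_; _^_; _≤_; _<_; _/_; _%_)
open import Data.Nat.Logarithm using (⌊log₂_⌋)
open import Data.Fin using (Fin; toℕ)
open import Data.Fin.Subset using (Subset; _∈_; _∉_; ∣_∣)
open import Data.List using (List; []; _∷_; _++_; [_]; length; tabulate)
open import Data.Nat.ListAction using (sum)
open import Data.List.Relation.Unary.All using (All)
open import Data.List.Relation.Unary.Unique.Propositional using (Unique)
open import Data.List.Relation.Unary.Linked using (Linked)
open import Data.Product using (Σ; ∃; ∃-syntax; _×_; _,_)
open import Data.Sum using (_⊎_)
open import Relation.Nullary using (¬_)
open import Relation.Binary.PropositionalEquality using (_≡_)

data Resp (n : ℕ) : Set where
  vert  : Fin n → Resp n
  pair  : Fin n → Fin n → Resp n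
  empty : Resp n

module Graph {n t : ℕ} (v : Fin t → Resp n) where

  data Occurs (x : Fin n) : Resp n → Set where
    in-vert : Occurs x (vert x)
    in-fst  : ∀ y → Occurs x (pair x y)
    in-snd  : ∀ y → Occurs x (pair y x)

  V : Fin n → Set
  V x = ∃[ i ] Occurs x (v i)

  Adj : Fin n → Fin n → Set
  Adj x y = ∃[ i ] (v i ≡ pair x y ⊎ v i ≡ pair y x)

  data Walk : Fin n → Fin n → ℕ → Set where
    here : ∀ {x} → Walk x x zero
    step : ∀ {x y z k} → Adj x y → Walk y z k → Walk x z (suc k)

  Reach : Fin n → Fin n → Set
  Reach x y = ∃[ k ] Walk x y k

  Dist : Fin n → Fin n → ℕ → Set
  Dist x y d = Walk x y d × (∀ k → k < d → ¬ Walk x y k)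

  HasCycle : Set
  HasCycle = ∃[ x ] ∃[ y ] ∃[ z ] ∃[ rest ]
    (Unique (x ∷ y ∷ z ∷ rest) × Linked Adj ((x ∷ y ∷ z ∷ rest) ++ [ x ]))

  -- r is the root (minimum vertex) of its connected component of G_o;
  -- the component is then { y | Reach r y }
  IsRoot : Fin n → Set
  IsRoot r = V r × (∀ y → Reach r y → toℕ r ≤ toℕ y)

  CompSizeAtMost : ℕ → Fin n → Set
  CompSizeAtMost L x = ∀ (ys : List (Fin n)) → Unique ys → All (Reach x) ys → length ys ≤ L

  ET : Set
  ET = (∀ x → ¬ Adj x x) × ¬ HasCycle × (∀ x → V x → CompSizeAtMost ⌊log₂ n ⌋ x)

  isNonEmpty : Resp n → ℕ
  isNonEmpty empty = 0
  isNonEmpty _     = 1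

  numNonEmpty : ℕ
  numNonEmpty = sum (tabulate (λ i → isNonEmpty (v i)))

  EF : Set
  EF = numNonEmpty * (⌊log₂ n ⌋ ^ 4) ≤ n

  Even Odd : ℕ → Set
  Even d = d % 2 ≡ 0
  Odd d = d % 2 ≡ 1

  EYes : Subset n → Set
  EYes A = ∀ r → IsRoot r →
    (∀ y → Reach r y → y ∈ A) ⊎ (∀ y → Reach r y → y ∉ A)

  -- Event E_{C,no}: for every component, odd layers ⊆ A and even layers ⊆ Ā, or vice versa.
  -- Root is layer 1, so vertex at distance d from the root is in layer d+1:
  -- odd layer ⇔ d even.
  ENo : Subset n → Set
  ENo A = ∀ r → IsRoot r →
    (∀ y d → Dist r y d → (Even d → y ∈ A) × (Odd d → y ∉ A))
    ⊎ (∀ y d → Dist r y d → (Even d → y ∉ A) × (Odd d → y ∈ A))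

-- #{A : |A| = ⌊n/2⌋, P A} ≤ (a/b) · #{A : |A| = ⌊n/2⌋, Q A}, phrased without decidability:
-- every duplicate-free list of P-sets is matched by a duplicate-free list of Q-sets.
-- (Equivalent to the probability inequality for uniform A of size ⌊n/2⌋: both sides
-- have the same denominator  n choose ⌊n/2⌋.)
CountRatio≤ : ∀ {n} → (Subset n → Set) → (Subset n → Set) → ℕ → ℕ → Set
CountRatio≤ {n} P Q a b =
  ∀ (Ly : List (Subset n)) → Unique Ly → All (λ A → ∣ A ∣ ≡ n / 2 × P A) Ly →
  ∃[ Ln ] (Unique Ln × All (λ A → ∣ A ∣ ≡ n / 2 × Q A) Ln × b * length Ly ≤ a * length Ln)

module Submission where

-- Root every component of G_o at its minimum vertex. A set A in E_yes (resp. E_no) is determined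
-- by one bit per component and its trace on the M free vertices, so both counts are sums of
-- M C (n/2 - y) over the possible sizes y of A on the occupied vertices: y ranges over sums of
-- p + q or 0 per component for E_yes, and of p or q for E_no (p, q the sizes of the two sides).
-- By unimodality the first sum is at most 2^#components · (M C c), c = M/2. Near the middle
-- M C (c + j) ≥ (M C c)(1 - j(j+1)/c), and by the parallelogram law the mean square deviation
-- of the E_no sizes from their centre is ∑ (p - q)² ≤ log n · #occupied, so the second sum is at
-- least (1 - O(log n · #occupied / n)) · 2^#components · (M C c). Finally E_F gives
-- #occupied ≤ 2n / log⁴ n, so the loss is o(1).

open import Data.Bool using (Bool; true; false; not; _xor_)
open import Data.Bool.Properties using (xor-identityʳ)
open import Data.Empty using (⊥-elim)
open import Data.Fin using (Fin; toℕ; fromℕ<)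
import Data.Fin as Fin
import Data.Fin.Properties as Fin
open import Data.Fin.Subset using (Subset; ∣_∣) renaming (_∈_ to _∈ˢ_; _∉_ to _∉ˢ_)
open import Data.List using (List; []; _∷_; _++_; map; length; replicate; filter; tabulate; allFin)
open import Data.List.Properties
  using (length-++; length-map; length-replicate; length-tabulate; map-++; map-∘; map-cong; map-cong-local; map-tabulate; ∷-injectiveʳ)
open import Data.List.Membership.Propositional using (_∈_)
import Data.List.Membership.Propositional.Properties as ∈
open import Data.List.Relation.Unary.All as All using (All; []; _∷_)
import Data.List.Relation.Unary.All.Properties as All
open import Data.List.Relation.Unary.AllPairs using ([]; _∷_)
open import Data.List.Relation.Unary.Any using (here; there)
open import Data.List.Relation.Unary.Unique.Propositional using (Unique)
import Data.List.Relation.Unary.Unique.Propositional.Properties as Unique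
open import Data.Nat
open import Data.Nat.Combinatorics using (_C_; nCk+nC[k+1]≡[n+1]C[k+1]; nCk≡nC[n∸k]; k>n⇒nCk≡0; nC1≡n)
open import Data.Nat.DivMod using (m≡m%n+[m/n]*n; m%n<n; m*n/n≡m; /-monoˡ-≤)
open import Data.Nat.Induction using (<-rec)
open import Data.Nat.ListAction using (sum)
open import Data.Nat.ListAction.Properties using (sum-++)
open import Data.Nat.Logarithm using (⌊log₂_⌋; ⌊log₂⌋-mono-≤; ⌊log₂[2^n]⌋≡n)
open import Data.Nat.Properties
open import Data.Nat.Tactic.RingSolver using (solve-∀)
open import Algebra.Properties.Semiring.Sum +-*-semiring
  using (sum-syntax; ∑-distrib-+; ∑-comm; sum-cong-≗; *-distribˡ-sum; sum-replicate-zero)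
open import Data.Product using (Σ; ∃; ∃-syntax; _×_; _,_; proj₁; proj₂)
open import Data.Sum using (_⊎_; inj₁; inj₂)
import Data.Vec as Vec
import Data.Vec.Properties as Vec
open import Function using (_∘_)
open import Relation.Binary.Definitions using (tri<; tri≈; tri>)
open import Relation.Binary.PropositionalEquality
open import Relation.Nullary using (Dec; yes; no; ¬_)
open import Relation.Nullary.Decidable using (isYes; _×-dec_; _⊎-dec_; ¬?; map′)
open import Relation.Unary using (Decidable)

open import Defs

_IsHalfOf_ : ℕ → ℕ → Set
c IsHalfOf n = c + c ≤ n × n ≤ suc (c + c)

/2-IsHalfOf : ∀ n → (n / 2) IsHalfOf n
/2-IsHalfOf n = (begin
    n / 2 + n / 2          ≡⟨ double (n / 2) ⟩
    n / 2 * 2              ≤⟨ m≤n+m _ (n % 2) ⟩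
    n % 2 + n / 2 * 2      ≡⟨ m≡m%n+[m/n]*n n 2 ⟨
    n                      ∎)
  , (begin
    n                      ≡⟨ m≡m%n+[m/n]*n n 2 ⟩
    n % 2 + n / 2 * 2      ≤⟨ +-monoˡ-≤ _ (≤-pred (m%n<n n 2)) ⟩
    1 + n / 2 * 2          ≡⟨ cong suc (double (n / 2)) ⟨
    suc (n / 2 + n / 2)    ∎)
  where
  open ≤-Reasoning
  double : ∀ x → x + x ≡ x * 2
  double = solve-∀

m*2≤n⇒m≤n/2 : ∀ {m n} → m * 2 ≤ n → m ≤ n / 2
m*2≤n⇒m≤n/2 {m} {n} m*2≤n = subst (_≤ n / 2) (m*n/n≡m m 2) (/-monoˡ-≤ 2 m*2≤n)

infixl 8 _²

_² : ℕ → ℕ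
x ² = x * x

∣m-n∣²+2mn≡m²+n²-≤ : ∀ {m n} → m ≤ n → ∣ m - n ∣ ² + 2 * (m * n) ≡ m ² + n ²
∣m-n∣²+2mn≡m²+n²-≤ {m} {n} m≤n =
  subst (λ z → ∣ m - z ∣ ² + 2 * (m * z) ≡ m ² + z ²) (m+[n∸m]≡n m≤n)
    (trans (cong (λ z → z ² + 2 * (m * (m + d))) (∣m-m+n∣≡n m d)) (expand m d))
  where
  d = n ∸ m
  expand : ∀ m d → d * d + 2 * (m * (m + d)) ≡ m * m + (m + d) * (m + d)
  expand = solve-∀

∣m-n∣²+2mn≡m²+n² : ∀ m n → ∣ m - n ∣ ² + 2 * (m * n) ≡ m ² + n ²
∣m-n∣²+2mn≡m²+n² m n with ≤-total m n
... | inj₁ m≤n = ∣m-n∣²+2mn≡m²+n²-≤ m≤n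
... | inj₂ n≤m = begin
  ∣ m - n ∣ ² + 2 * (m * n) ≡⟨ cong₂ (λ u w → u ² + 2 * w) (∣-∣-comm m n) (*-comm m n) ⟩
  ∣ n - m ∣ ² + 2 * (n * m) ≡⟨ ∣m-n∣²+2mn≡m²+n²-≤ n≤m ⟩
  n ² + m ²                 ≡⟨ +-comm (n ²) (m ²) ⟩
  m ² + n ²                 ∎
  where open ≡-Reasoning

-- The parallelogram law (a + b)² + (a - b)² = 2a² + 2b² for a = S - 2y, b = p - q.
parallelogram : ∀ p q S y →
  ∣ (p + q + S) - 2 * (p + y) ∣ ² + ∣ (p + q + S) - 2 * (q + y) ∣ ² ≡ 2 * ∣ S - 2 * y ∣ ² + 2 * ∣ p - q ∣ ²
parallelogram p q S y = +-cancelʳ-≡ cross _ _ (begin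
    (x₁ ² + x₂ ²) + cross
      ≡⟨ shuffle (x₁ ²) (x₂ ²) T (2 * (p + y)) (2 * (q + y)) ⟩
    (x₁ ² + 2 * (T * (2 * (p + y)))) + (x₂ ² + 2 * (T * (2 * (q + y))))
      ≡⟨ cong₂ _+_ (∣m-n∣²+2mn≡m²+n² T (2 * (p + y))) (∣m-n∣²+2mn≡m²+n² T (2 * (q + y))) ⟩
    (T ² + (2 * (p + y)) ²) + (T ² + (2 * (q + y)) ²)
      ≡⟨ expand p q S y ⟩
    2 * (S ² + (2 * y) ²) + 2 * (p ² + q ²) + rest
      ≡⟨ cong₂ (λ a b → 2 * a + 2 * b + rest) (∣m-n∣²+2mn≡m²+n² S (2 * y)) (∣m-n∣²+2mn≡m²+n² p q) ⟨
    2 * (u ² + 2 * (S * (2 * y))) + 2 * (w ² + 2 * (p * q)) + rest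
      ≡⟨ collect (u ²) (w ²) p q S y ⟩
    (2 * u ² + 2 * w ²) + cross ∎)
  where
  open ≡-Reasoning
  T = p + q + S
  x₁ = ∣ T - 2 * (p + y) ∣
  x₂ = ∣ T - 2 * (q + y) ∣
  u = ∣ S - 2 * y ∣
  w = ∣ p - q ∣
  cross = 2 * (T * (2 * (p + y))) + 2 * (T * (2 * (q + y)))
  rest = 4 * (p * p) + 4 * (p * q) + 4 * (q * q) + 8 * (y * (p + q)) + 4 * (S * (p + q))
  shuffle : ∀ a b T c d → (a + b) + (2 * (T * c) + 2 * (T * d)) ≡ (a + 2 * (T * c)) + (b + 2 * (T * d))
  shuffle = solve-∀
  expand : ∀ p q S y →
    ((p + q + S) * (p + q + S) + (2 * (p + y)) * (2 * (p + y))) + ((p + q + S) * (p + q + S) + (2 * (q + y)) * (2 * (q + y)))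
    ≡ 2 * (S * S + (2 * y) * (2 * y)) + 2 * (p * p + q * q)
      + (4 * (p * p) + 4 * (p * q) + 4 * (q * q) + 8 * (y * (p + q)) + 4 * (S * (p + q)))
  expand = solve-∀
  collect : ∀ a b p q S y →
    2 * (a + 2 * (S * (2 * y))) + 2 * (b + 2 * (p * q))
      + (4 * (p * p) + 4 * (p * q) + 4 * (q * q) + 8 * (y * (p + q)) + 4 * (S * (p + q)))
    ≡ (2 * a + 2 * b) + (2 * ((p + q + S) * (2 * (p + y))) + 2 * ((p + q + S) * (2 * (q + y))))
  collect = solve-∀

pascal : ∀ n k → suc n C suc k ≡ n C k + n C suc k
pascal n k = sym (nCk+nC[k+1]≡[n+1]C[k+1] n k)

C-absorption : ∀ n k → suc k * (suc n C suc k) ≡ suc n * (n C k)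
C-absorption zero zero = refl
C-absorption zero (suc k) = trans (cong (suc (suc k) *_) (k>n⇒nCk≡0 {n = 1} (s≤s (s≤s (z≤n {k}))))) (*-zeroʳ (suc (suc k)))
C-absorption (suc n) zero = trans (*-identityˡ _) (trans (nC1≡n (suc (suc n))) (sym (*-identityʳ (suc (suc n)))))
C-absorption (suc n) (suc k) = begin
    suc (suc k) * (suc (suc n) C suc (suc k))
      ≡⟨ cong (suc (suc k) *_) (pascal (suc n) (suc k)) ⟩
    suc (suc k) * (x + y)
      ≡⟨ split x y k ⟩
    (suc k * x + suc (suc k) * y) + x
      ≡⟨ cong₂ (λ a b → (a + b) + x) (C-absorption n k) (C-absorption n (suc k)) ⟩
    (suc n * (n C k) + suc n * (n C suc k)) + x
      ≡⟨ cong (λ z → (suc n * (n C k) + suc n * (n C suc k)) + z) (pascal n k) ⟩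
    (suc n * (n C k) + suc n * (n C suc k)) + ((n C k) + (n C suc k))
      ≡⟨ merge (n C k) (n C suc k) n ⟩
    suc (suc n) * ((n C k) + (n C suc k))
      ≡⟨ cong (suc (suc n) *_) (pascal n k) ⟨
    suc (suc n) * (suc n C suc k) ∎
  where
  open ≡-Reasoning
  x = suc n C suc k
  y = suc n C suc (suc k)
  split : ∀ x y k → suc (suc k) * (x + y) ≡ (suc k * x + suc (suc k) * y) + x
  split = solve-∀
  merge : ∀ a b n → (suc n * a + suc n * b) + (a + b) ≡ suc (suc n) * (a + b)
  merge = solve-∀

-- The ratio (n C k+1) / (n C k) = (n - k) / (k + 1), cleared of denominators and subtraction.
C-successor-ratio : ∀ n k → suc k * (n C suc k) + suc k * (n C k) ≡ suc n * (n C k)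
C-successor-ratio n k = begin
    suc k * (n C suc k) + suc k * (n C k) ≡⟨ *-distribˡ-+ (suc k) (n C suc k) (n C k) ⟨
    suc k * ((n C suc k) + (n C k))      ≡⟨ cong (suc k *_) (+-comm (n C suc k) (n C k)) ⟩
    suc k * ((n C k) + (n C suc k))      ≡⟨ cong (suc k *_) (pascal n k) ⟨
    suc k * (suc n C suc k)              ≡⟨ C-absorption n k ⟩
    suc n * (n C k)                      ∎
  where open ≡-Reasoning

C-antitone-step : ∀ n k → n ≤ suc (k + k) → n C suc k ≤ n C k
C-antitone-step n k n≤ = *-cancelˡ-≤ (suc k) (+-cancelʳ-≤ _ _ _ (begin
    suc k * (n C suc k) + suc k * (n C k) ≡⟨ C-successor-ratio n k ⟩
    suc n * (n C k)                      ≤⟨ *-monoˡ-≤ (n C k) (s≤s n≤) ⟩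
    suc (suc (k + k)) * (n C k)          ≡⟨ double (n C k) k ⟩
    suc k * (n C k) + suc k * (n C k)    ∎))
  where
  open ≤-Reasoning
  double : ∀ b k → suc (suc (k + k)) * b ≡ suc k * b + suc k * b
  double = solve-∀

C-antitone-from-middle : ∀ n c → n ≤ suc (c + c) → ∀ d → n C (c + d) ≤ n C c
C-antitone-from-middle n c n≤ zero = ≤-reflexive (cong (n C_) (+-identityʳ c))
C-antitone-from-middle n c n≤ (suc d) = begin
  n C (c + suc d)  ≡⟨ cong (n C_) (+-suc c d) ⟩
  n C suc (c + d)  ≤⟨ C-antitone-step n (c + d) (≤-trans n≤ (s≤s (+-mono-≤ (m≤m+n c d) (m≤m+n c d)))) ⟩
  n C (c + d)      ≤⟨ C-antitone-from-middle n c n≤ d ⟩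
  n C c            ∎
  where open ≤-Reasoning

C-≤-middle : ∀ n c → c IsHalfOf n → ∀ k → n C k ≤ n C c
C-≤-middle n c (c+c≤n , n≤) k with c ≤? k | n <? k
... | yes c≤k | _ = subst (λ z → n C z ≤ n C c) (m+[n∸m]≡n c≤k) (C-antitone-from-middle n c n≤ (k ∸ c))
... | no _ | yes n<k = subst (_≤ n C c) (sym (k>n⇒nCk≡0 n<k)) z≤n
... | no c≰k | no n≮k = begin
  n C k                   ≡⟨ nCk≡nC[n∸k] (≮⇒≥ n≮k) ⟩
  n C (n ∸ k)             ≡⟨ cong (n C_) (m+[n∸m]≡n c≤n∸k) ⟨
  n C (c + (n ∸ k ∸ c))   ≤⟨ C-antitone-from-middle n c n≤ (n ∸ k ∸ c) ⟩
  n C c                   ∎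
  where
  open ≤-Reasoning
  c≤n∸k : c ≤ n ∸ k
  c≤n∸k = ≤-trans (m+n≤o⇒m≤o∸n c c+c≤n) (∸-monoʳ-≤ n (<⇒≤ (≰⇒> c≰k)))

private
  deficit-ratio : ∀ (b b' j r n : ℕ) → let c = suc j * suc (suc j) + r in
    c + c ≤ n → suc (c + j) * b' + suc (c + j) * b ≡ suc n * b →
    (suc j * suc j + r) * b ≤ suc (c + j) * b'
  deficit-ratio b b' j r n c+c≤n ratio = +-cancelˡ-≤ (s * b) _ _ (begin
      s * b + Q * b  ≡⟨ *-distribʳ-+ b s Q ⟨
      (s + Q) * b    ≡⟨ cong (_* b) (regroup j r) ⟩
      (c + c) * b    ≤⟨ *-monoˡ-≤ b (m≤n⇒m≤1+n c+c≤n) ⟩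
      suc n * b      ≡⟨ ratio ⟨
      s * b' + s * b ≡⟨ +-comm (s * b') _ ⟩
      s * b + s * b' ∎)
    where
    open ≤-Reasoning
    c = suc j * suc (suc j) + r
    s = suc (c + j)
    Q = suc j * suc j + r
    regroup : ∀ j r → suc ((suc j * suc (suc j) + r) + j) + (suc j * suc j + r)
                    ≡ (suc j * suc (suc j) + r) + (suc j * suc (suc j) + r)
    regroup = solve-∀

  deficit-step : ∀ (b₀ b b' j r : ℕ) → let c = suc j * suc (suc j) + r in
    b₀ * c ≤ b * c + b₀ * (j * suc j) →
    (suc j * suc j + r) * b ≤ suc (c + j) * b' →
    b₀ * c ≤ b' * c + b₀ * (suc j * suc (suc j))
  deficit-step b₀ b b' j r IH ratio = begin
      b₀ * c           ≡⟨ *-distribˡ-+ b₀ a r ⟩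
      b₀ * a + b₀ * r  ≤⟨ +-monoʳ-≤ (b₀ * a) b₀r≤b'c ⟩
      b₀ * a + b' * c  ≡⟨ +-comm (b₀ * a) _ ⟩
      b' * c + b₀ * a  ∎
    where
    open ≤-Reasoning
    a = suc j * suc (suc j)
    c = a + r
    s = suc (c + j)
    P = 2 + 2 * j + r
    Q = suc j * suc j + r
    b₀P≤bc : b₀ * P ≤ b * c
    b₀P≤bc = +-cancelˡ-≤ (b₀ * (j * suc j)) _ _ (begin
        b₀ * (j * suc j) + b₀ * P ≡⟨ split-c b₀ j r ⟩
        b₀ * c                    ≤⟨ IH ⟩
        b * c + b₀ * (j * suc j)  ≡⟨ +-comm (b * c) _ ⟩
        b₀ * (j * suc j) + b * c  ∎)
      where
      split-c : ∀ b₀ j r → b₀ * (j * suc j) + b₀ * (2 + 2 * j + r) ≡ b₀ * (suc j * suc (suc j) + r)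
      split-c = solve-∀
    b₀r≤b'c : b₀ * r ≤ b' * c
    b₀r≤b'c = *-cancelʳ-≤ (b₀ * r) (b' * c) s (begin
        b₀ * r * s                                 ≤⟨ m≤m+n _ _ ⟩
        b₀ * r * s + b₀ * (2 * (suc j * suc j * suc j)) ≡⟨ expand b₀ j r ⟩
        b₀ * P * Q                                 ≤⟨ *-monoˡ-≤ Q b₀P≤bc ⟩
        b * c * Q                                  ≡⟨ pull-c b c Q ⟩
        c * (Q * b)                                ≤⟨ *-monoʳ-≤ c ratio ⟩
        c * (s * b')                               ≡⟨ push-c c s b' ⟩
        b' * c * s                                 ∎)
      where
      expand : ∀ b₀ j r → b₀ * r * suc ((suc j * suc (suc j) + r) + j) + b₀ * (2 * (suc j * suc j * suc j))
                    ≡ b₀ * (2 + 2 * j + r) * (suc j * suc j + r)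
      expand = solve-∀
      pull-c : ∀ b c Q → b * c * Q ≡ c * (Q * b)
      pull-c = solve-∀
      push-c : ∀ c s b → c * (s * b) ≡ b * c * s
      push-c = solve-∀

C-central-deficit : ∀ n c → c + c ≤ n → ∀ j →
  (n C c) * c ≤ (n C (c + j)) * c + (n C c) * (j * suc j)
C-central-deficit n c c+c≤n zero = begin
    (n C c) * c                       ≡⟨ cong (λ z → (n C z) * c) (+-identityʳ c) ⟨
    (n C (c + 0)) * c                 ≤⟨ m≤m+n _ _ ⟩
    (n C (c + 0)) * c + (n C c) * 0   ∎
  where open ≤-Reasoning
C-central-deficit n c c+c≤n (suc j) with c ≤? suc j * suc (suc j)
... | yes c≤ = ≤-trans (*-monoʳ-≤ (n C c) c≤) (m≤n+m _ _)
... | no c≰ = step (c ∸ a) (sym (m+[n∸m]≡n (<⇒≤ (≰⇒> c≰))))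
  where
  a = suc j * suc (suc j)
  step : ∀ r → c ≡ a + r → (n C c) * c ≤ (n C (c + suc j)) * c + (n C c) * a
  step r refl = subst (λ z → (n C c) * c ≤ (n C z) * c + (n C c) * a) (sym (+-suc c j))
    (deficit-step (n C c) (n C (c + j)) (n C suc (c + j)) j r
      (C-central-deficit n c c+c≤n j)
      (deficit-ratio (n C (c + j)) (n C suc (c + j)) j r n c+c≤n (C-successor-ratio n (c + j))))

C-central-deficit-either-side : ∀ n c → c + c ≤ n → ∀ k j q → (k ≡ c + j ⊎ n ∸ k ≡ c + j) → k ≤ n →
  j * suc j ≤ q → (n C c) * c ≤ (n C k) * c + (n C c) * q
C-central-deficit-either-side n c c+c≤n k j q side k≤n jj≤q =
  ≤-trans (C-central-deficit n c c+c≤n j) (+-mono-≤ (≤-reflexive (cong (_* c) (C-at side))) (*-monoʳ-≤ (n C c) jj≤q))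
  where
  C-at : (k ≡ c + j ⊎ n ∸ k ≡ c + j) → n C (c + j) ≡ n C k
  C-at (inj₁ k≡) = cong (n C_) (sym k≡)
  C-at (inj₂ n∸k≡) = trans (cong (n C_) (sym n∸k≡)) (sym (nCk≡nC[n∸k] k≤n))

m+n≤k+o⇒m≤k+∣o-n∣ : ∀ m n o k → m + n ≤ k + o → m ≤ k + ∣ o - n ∣
m+n≤k+o⇒m≤k+∣o-n∣ m n o k m+n≤ = begin
  m                          ≤⟨ m+n≤o⇒m≤o∸n m m+n≤ ⟩
  k + o ∸ n                  ≤⟨ m∸n≤∣m-n∣ (k + o) n ⟩
  ∣ k + o - n ∣              ≤⟨ ∣-∣-triangle (k + o) o n ⟩
  ∣ k + o - o ∣ + ∣ o - n ∣  ≡⟨ cong (_+ ∣ o - n ∣) (trans (∣-∣-comm (k + o) o) (trans (cong ∣ o -_∣ (+-comm k o)) (∣m-m+n∣≡n o k))) ⟩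
  k + ∣ o - n ∣              ∎
  where open ≤-Reasoning

m+m≤2+n⇒m≤1+n : ∀ m n → m + m ≤ 2 + n → m ≤ 1 + n
m+m≤2+n⇒m≤1+n zero n _ = z≤n
m+m≤2+n⇒m≤1+n (suc m) n (s≤s m+1+m≤1+n) =
  s≤s (≤-trans (m≤m+n m m) (≤-pred (≤-trans (≤-reflexive (sym (+-suc m m))) m+1+m≤1+n)))

m≤1+n⇒m[1+m]≤2n²+8 : ∀ m n → m ≤ suc n → m * suc m ≤ 2 * n ² + 8
m≤1+n⇒m[1+m]≤2n²+8 m n m≤ = begin
    m * suc m                             ≤⟨ *-mono-≤ m≤ (s≤s m≤) ⟩
    suc n * suc (suc n)                   ≤⟨ m≤m+n _ (∣ n - 2 ∣ ² + n) ⟩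
    suc n * suc (suc n) + (∣ n - 2 ∣ ² + n) ≡⟨ +-cancelʳ-≡ (2 * (n * 2)) _ _ completed ⟩
    2 * n ² + 6                           ≤⟨ +-monoʳ-≤ (2 * n ²) (s≤s (s≤s (s≤s (s≤s (s≤s (s≤s z≤n)))))) ⟩
    2 * n ² + 8                           ∎
  where
  open ≤-Reasoning
  shuffle : ∀ n x → (suc n * suc (suc n) + (x + n)) + 2 * (n * 2) ≡ (suc n * suc (suc n) + n) + (x + 2 * (n * 2))
  shuffle = solve-∀
  expand : ∀ n → (suc n * suc (suc n) + n) + (n * n + 2 * 2) ≡ (2 * (n * n) + 6) + 2 * (n * 2)
  expand = solve-∀
  completed : (suc n * suc (suc n) + (∣ n - 2 ∣ ² + n)) + 2 * (n * 2) ≡ (2 * n ² + 6) + 2 * (n * 2)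
  completed = trans (shuffle n (∣ n - 2 ∣ ²)) (trans (cong ((suc n * suc (suc n) + n) +_) (∣m-n∣²+2mn≡m²+n² n 2)) (expand n))

private
  right-offset : ∀ c j y h M S → (c + j) + y ≡ h → h + h ≤ M + S → M ≤ suc (c + c) →
    j + j ≤ 1 + ∣ S - 2 * y ∣
  right-offset c j y h M S refl 2h≤ M≤ = m+n≤k+o⇒m≤k+∣o-n∣ (j + j) (2 * y) S 1
    (+-cancelʳ-≤ (c + c) _ _ (begin
      (j + j + 2 * y) + (c + c)        ≡⟨ double c j y ⟩
      ((c + j) + y) + ((c + j) + y)    ≤⟨ 2h≤ ⟩
      M + S                            ≤⟨ +-monoˡ-≤ S M≤ ⟩
      suc (c + c) + S                  ≡⟨ +-comm (suc (c + c)) S ⟩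
      S + suc (c + c)                  ≡⟨ +-suc S (c + c) ⟩
      (1 + S) + (c + c)                ∎))
    where
    open ≤-Reasoning
    double : ∀ c j y → (j + j + 2 * y) + (c + c) ≡ ((c + j) + y) + ((c + j) + y)
    double = solve-∀

  left-offset : ∀ c j k y M S → M ≡ k + (c + j) → M + S ≤ suc ((k + y) + (k + y)) → M ≤ suc (c + c) →
    j + j ≤ 2 + ∣ S - 2 * y ∣
  left-offset c j k y M S refl M+S≤ M≤ =
    subst (λ z → j + j ≤ 2 + z) (∣-∣-comm (2 * y) S)
      (m+n≤k+o⇒m≤k+∣o-n∣ (j + j) S (2 * y) 2 (+-cancelʳ-≤ M _ _ (begin
        (j + j + S) + M            ≡⟨ regroup j S M ⟩
        (j + j) + (M + S)          ≤⟨ +-monoʳ-≤ (j + j) M+S≤ ⟩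
        j + j + suc ((k + y) + (k + y))   ≡⟨ expand j k y ⟩
        suc ((j + j + (k + k)) + 2 * y)   ≤⟨ s≤s (+-monoˡ-≤ (2 * y) 2j+2k≤1+M) ⟩
        suc (suc M + 2 * y)        ≡⟨ collect M y ⟩
        (2 + 2 * y) + M            ∎)))
    where
    open ≤-Reasoning
    regroup : ∀ j S M → (j + j + S) + M ≡ (j + j) + (M + S)
    regroup = solve-∀
    expand : ∀ j k y → j + j + suc ((k + y) + (k + y)) ≡ suc ((j + j + (k + k)) + 2 * y)
    expand = solve-∀
    collect : ∀ M y → suc (suc M + 2 * y) ≡ (2 + 2 * y) + M
    collect = solve-∀
    2j+2k≤1+M : j + j + (k + k) ≤ suc M
    2j+2k≤1+M = +-cancelʳ-≤ M _ _ (begin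
      (j + j + (k + k)) + M            ≤⟨ +-monoʳ-≤ (j + j + (k + k)) M≤ ⟩
      (j + j + (k + k)) + suc (c + c)  ≡⟨ unfold-M j k c ⟩
      suc M + M                        ∎)
      where
      unfold-M : ∀ j k c → (j + j + (k + k)) + suc (c + c) ≡ suc (k + (c + j)) + (k + (c + j))
      unfold-M = solve-∀

C-deficit-at-shift : ∀ M c h S y → c IsHalfOf M → h IsHalfOf (M + S) → S ≤ h → y ≤ S →
  (M C c) * c ≤ (M C (h ∸ y)) * c + (M C c) * (2 * ∣ S - 2 * y ∣ ² + 8)
C-deficit-at-shift M c h S y (c+c≤M , M≤) (2h≤ , ≤2h+1) S≤h y≤S = by-side (c ≤? k)
  where
  k = h ∸ y
  u = ∣ S - 2 * y ∣
  k+y≡h : k + y ≡ h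
  k+y≡h = m∸n+n≡m (≤-trans y≤S S≤h)
  k≤M : k ≤ M
  k≤M = ≤-trans (m∸n≤m h y) (+-cancelʳ-≤ h h M (≤-trans 2h≤ (+-monoʳ-≤ M S≤h)))
  by-side : Dec (c ≤ k) → (M C c) * c ≤ (M C k) * c + (M C c) * (2 * u ² + 8)
  by-side (yes c≤k) = C-central-deficit-either-side M c c+c≤M k j _ (inj₁ (sym c+j≡k)) k≤M
      (m≤1+n⇒m[1+m]≤2n²+8 j u (≤-trans (m≤m+n j j)
        (right-offset c j y h M S (trans (cong (_+ y) c+j≡k) k+y≡h) 2h≤ M≤)))
    where
    j = k ∸ c
    c+j≡k : c + j ≡ k
    c+j≡k = m+[n∸m]≡n c≤k
  by-side (no c≰k) = C-central-deficit-either-side M c c+c≤M k j _ (inj₂ (sym c+j≡M∸k)) k≤M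
      (m≤1+n⇒m[1+m]≤2n²+8 j u (m+m≤2+n⇒m≤1+n j u
        (left-offset c j k y M S M≡ (subst (λ z → M + S ≤ suc (z + z)) (sym k+y≡h) ≤2h+1) M≤)))
    where
    c≤M∸k : c ≤ M ∸ k
    c≤M∸k = ≤-trans (m+n≤o⇒m≤o∸n c c+c≤M) (∸-monoʳ-≤ M (<⇒≤ (≰⇒> c≰k)))
    j = M ∸ k ∸ c
    c+j≡M∸k : c + j ≡ M ∸ k
    c+j≡M∸k = m+[n∸m]≡n c≤M∸k
    M≡ : M ≡ k + (c + j)
    M≡ = trans (sym (m+[n∸m]≡n k≤M)) (cong (k +_) (sym c+j≡M∸k))

module _ {A : Set} where

  sum-map-++ : ∀ (f : A → ℕ) xs ys → sum (map f (xs ++ ys)) ≡ sum (map f xs) + sum (map f ys)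
  sum-map-++ f xs ys = trans (cong sum (map-++ f xs ys)) (sum-++ (map f xs) (map f ys))

  sum-map-+ : ∀ (f g : A → ℕ) xs → sum (map (λ x → f x + g x) xs) ≡ sum (map f xs) + sum (map g xs)
  sum-map-+ f g [] = refl
  sum-map-+ f g (x ∷ xs) = trans (cong (f x + g x +_) (sum-map-+ f g xs)) (+-+-comm (f x) (g x) _ _)
    where
    +-+-comm : ∀ a b c d → a + b + (c + d) ≡ a + c + (b + d)
    +-+-comm = solve-∀

  sum-map-*ˡ : ∀ k (f : A → ℕ) xs → sum (map (λ x → k * f x) xs) ≡ k * sum (map f xs)
  sum-map-*ˡ k f [] = sym (*-zeroʳ k)
  sum-map-*ˡ k f (x ∷ xs) = trans (cong (k * f x +_) (sum-map-*ˡ k f xs)) (sym (*-distribˡ-+ k (f x) _))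

  sum-map-*ʳ : ∀ k (f : A → ℕ) xs → sum (map (λ x → f x * k) xs) ≡ sum (map f xs) * k
  sum-map-*ʳ k f [] = refl
  sum-map-*ʳ k f (x ∷ xs) = trans (cong (f x * k +_) (sum-map-*ʳ k f xs)) (sym (*-distribʳ-+ k (f x) _))

  sum-map-const : ∀ k (xs : List A) → sum (map (λ _ → k) xs) ≡ length xs * k
  sum-map-const k [] = refl
  sum-map-const k (x ∷ xs) = cong (k +_) (sum-map-const k xs)

  sum-map-cong : ∀ {f g : A → ℕ} → (∀ x → f x ≡ g x) → ∀ xs → sum (map f xs) ≡ sum (map g xs)
  sum-map-cong f≗g xs = cong sum (map-cong f≗g xs)

  sum-map-cong-local : ∀ {f g : A → ℕ} {xs} → All (λ x → f x ≡ g x) xs → sum (map f xs) ≡ sum (map g xs)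
  sum-map-cong-local [] = refl
  sum-map-cong-local (e ∷ es) = cong₂ _+_ e (sum-map-cong-local es)

  sum-map-mono : ∀ {f g : A → ℕ} xs → All (λ x → f x ≤ g x) xs → sum (map f xs) ≤ sum (map g xs)
  sum-map-mono [] [] = z≤n
  sum-map-mono (x ∷ xs) (le ∷ les) = +-mono-≤ le (sum-map-mono xs les)

𝟙 : Bool → ℕ
𝟙 true = 1
𝟙 false = 0

⟦_⟧ : ∀ {P : Set} → Dec P → ℕ
⟦ d ⟧ = 𝟙 (isYes d)

⟦⟧-yes : ∀ {P : Set} (d : Dec P) → P → ⟦ d ⟧ ≡ 1
⟦⟧-yes (yes _) _ = refl
⟦⟧-yes (no ¬p) p = ⊥-elim (¬p p)

⟦⟧-no : ∀ {P : Set} (d : Dec P) → ¬ P → ⟦ d ⟧ ≡ 0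
⟦⟧-no (yes p) ¬p = ⊥-elim (¬p p)
⟦⟧-no (no _) _ = refl

⟦⟧-× : ∀ {P Q : Set} (a : Dec P) (b : Dec Q) → ⟦ a ×-dec b ⟧ ≡ ⟦ a ⟧ * ⟦ b ⟧
⟦⟧-× (yes _) (yes _) = refl
⟦⟧-× (yes _) (no _) = refl
⟦⟧-× (no _) _ = refl

⟦⟧+⟦¬⟧≡1 : ∀ {P : Set} (d : Dec P) → ⟦ d ⟧ + ⟦ ¬? d ⟧ ≡ 1
⟦⟧+⟦¬⟧≡1 (yes _) = refl
⟦⟧+⟦¬⟧≡1 (no _) = refl

-- A block (p , q) is a component with p vertices on the root's side and q on the other;
-- a choice sum is the size of A on the occupied vertices for one choice of side per block.
Weights : Set
Weights = List (ℕ × ℕ)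

choiceSums : Weights → List ℕ
choiceSums [] = 0 ∷ []
choiceSums ((p , q) ∷ ws) = map (p +_) (choiceSums ws) ++ map (q +_) (choiceSums ws)

total : Weights → ℕ
total [] = 0
total ((p , q) ∷ ws) = p + q + total ws

imbalance : Weights → ℕ
imbalance [] = 0
imbalance ((p , q) ∷ ws) = ∣ p - q ∣ ² + imbalance ws

unsplit : Weights → Weights
unsplit [] = []
unsplit ((p , q) ∷ ws) = (p + q , 0) ∷ unsplit ws

length-choiceSums : ∀ ws → length (choiceSums ws) ≡ 2 ^ length ws
length-choiceSums [] = refl
length-choiceSums ((p , q) ∷ ws) = begin
    length (map (p +_) ys ++ map (q +_) ys)         ≡⟨ length-++ (map (p +_) ys) ⟩
    length (map (p +_) ys) + length (map (q +_) ys) ≡⟨ cong₂ _+_ (length-map (p +_) ys) (length-map (q +_) ys) ⟩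
    length ys + length ys                           ≡⟨ cong (λ z → z + z) (length-choiceSums ws) ⟩
    2 ^ length ws + 2 ^ length ws                   ≡⟨ cong (2 ^ length ws +_) (+-identityʳ _) ⟨
    2 ^ suc (length ws)                             ∎
  where
  open ≡-Reasoning
  ys = choiceSums ws

length-unsplit : ∀ ws → length (unsplit ws) ≡ length ws
length-unsplit [] = refl
length-unsplit (_ ∷ ws) = cong suc (length-unsplit ws)

total-unsplit : ∀ ws → total (unsplit ws) ≡ total ws
total-unsplit [] = refl
total-unsplit ((p , q) ∷ ws) = cong₂ _+_ (+-identityʳ (p + q)) (total-unsplit ws)

total-map : ∀ {A : Set} (w : A → ℕ × ℕ) xs → total (map w xs) ≡ sum (map (λ x → proj₁ (w x) + proj₂ (w x)) xs)
total-map w [] = refl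
total-map w (x ∷ xs) = cong (proj₁ (w x) + proj₂ (w x) +_) (total-map w xs)

imbalance-map : ∀ {A : Set} (w : A → ℕ × ℕ) xs → imbalance (map w xs) ≡ sum (map (λ x → ∣ proj₁ (w x) - proj₂ (w x) ∣ ²) xs)
imbalance-map w [] = refl
imbalance-map w (x ∷ xs) = cong (∣ proj₁ (w x) - proj₂ (w x) ∣ ² +_) (imbalance-map w xs)

choiceSums-≤-total : ∀ ws → All (_≤ total ws) (choiceSums ws)
choiceSums-≤-total [] = z≤n ∷ []
choiceSums-≤-total ((p , q) ∷ ws) = All.++⁺
  (All.map⁺ (All.map (λ y≤ → ≤-trans (+-monoʳ-≤ p y≤) (+-monoˡ-≤ (total ws) (m≤m+n p q))) IH))
  (All.map⁺ (All.map (λ y≤ → ≤-trans (+-monoʳ-≤ q y≤) (≤-trans (m≤n+m _ p) (≤-reflexive (sym (+-assoc p q (total ws)))))) IH))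
  where
  IH = choiceSums-≤-total ws

-- The deviations of the choice sums from their mean total/2 have the same sum of squares as
-- independent ±(p - q)/2 signs, by the parallelogram law applied to each pair (p , q).
sum-deviation² : ∀ ws →
  sum (map (λ y → ∣ total ws - 2 * y ∣ ²) (choiceSums ws)) ≡ length (choiceSums ws) * imbalance ws
sum-deviation² [] = refl
sum-deviation² ((p , q) ∷ ws) = begin
    sum (map dev (map (p +_) ys ++ map (q +_) ys))
      ≡⟨ sum-map-++ dev (map (p +_) ys) _ ⟩
    sum (map dev (map (p +_) ys)) + sum (map dev (map (q +_) ys))
      ≡⟨ cong₂ _+_ (cong sum (map-∘ ys)) (cong sum (map-∘ ys)) ⟨
    sum (map (λ y → dev (p + y)) ys) + sum (map (λ y → dev (q + y)) ys)
      ≡⟨ sum-map-+ (λ y → dev (p + y)) _ ys ⟨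
    sum (map (λ y → dev (p + y) + dev (q + y)) ys)
      ≡⟨ sum-map-cong (parallelogram p q (total ws)) ys ⟩
    sum (map (λ y → 2 * dev₀ y + 2 * ∣ p - q ∣ ²) ys)
      ≡⟨ sum-map-+ (λ y → 2 * dev₀ y) _ ys ⟩
    sum (map (λ y → 2 * dev₀ y) ys) + sum (map (λ _ → 2 * ∣ p - q ∣ ²) ys)
      ≡⟨ cong₂ _+_ (sum-map-*ˡ 2 dev₀ ys) (sum-map-const _ ys) ⟩
    2 * sum (map dev₀ ys) + ℓ * (2 * ∣ p - q ∣ ²)
      ≡⟨ cong (λ z → 2 * z + ℓ * (2 * ∣ p - q ∣ ²)) (sum-deviation² ws) ⟩
    2 * (ℓ * imbalance ws) + ℓ * (2 * ∣ p - q ∣ ²)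
      ≡⟨ regroup ℓ (imbalance ws) (∣ p - q ∣ ²) ⟩
    (ℓ + ℓ) * (∣ p - q ∣ ² + imbalance ws)
      ≡⟨ cong (_* (∣ p - q ∣ ² + imbalance ws)) length-ys ⟨
    length (map (p +_) ys ++ map (q +_) ys) * (∣ p - q ∣ ² + imbalance ws) ∎
  where
  open ≡-Reasoning
  ys = choiceSums ws
  ℓ = length ys
  dev = λ y → ∣ p + q + total ws - 2 * y ∣ ²
  dev₀ = λ y → ∣ total ws - 2 * y ∣ ²
  length-ys : length (map (p +_) ys ++ map (q +_) ys) ≡ ℓ + ℓ
  length-ys = trans (length-++ (map (p +_) ys)) (cong₂ _+_ (length-map (p +_) ys) (length-map (q +_) ys))
  regroup : ∀ l d s → 2 * (l * d) + l * (2 * s) ≡ (l + l) * (s + d)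
  regroup = solve-∀

sum-C-≤-middle : ∀ M c h → c IsHalfOf M → ∀ ys → sum (map (λ y → M C (h ∸ y)) ys) ≤ length ys * (M C c)
sum-C-≤-middle M c h half ys = begin
  sum (map (λ y → M C (h ∸ y)) ys) ≤⟨ sum-map-mono ys (All.tabulate (λ {y} _ → C-≤-middle M c half (h ∸ y))) ⟩
  sum (map (λ _ → M C c) ys)       ≡⟨ sum-map-const (M C c) ys ⟩
  length ys * (M C c)              ∎
  where open ≤-Reasoning

sum-C-deficit : ∀ M c h ws → c IsHalfOf M → h IsHalfOf (M + total ws) → total ws ≤ h →
  let ys = choiceSums ws in
  length ys * (M C c) * c ≤ sum (map (λ y → M C (h ∸ y)) ys) * c + length ys * (M C c) * (2 * imbalance ws + 8)
sum-C-deficit M c h ws c-half h-half S≤h = begin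
    ℓ * Cc * c                                      ≡⟨ *-assoc ℓ Cc c ⟩
    ℓ * (Cc * c)                                    ≡⟨ sum-map-const (Cc * c) ys ⟨
    sum (map (λ _ → Cc * c) ys)                     ≤⟨ sum-map-mono ys (All.map pointwise (choiceSums-≤-total ws)) ⟩
    sum (map (λ y → F y * c + Cc * penalty y) ys)   ≡⟨ sum-map-+ (λ y → F y * c) (λ y → Cc * penalty y) ys ⟩
    sum (map (λ y → F y * c) ys) + sum (map (λ y → Cc * penalty y) ys)
      ≡⟨ cong₂ _+_ (sum-map-*ʳ c F ys) (sum-map-*ˡ Cc penalty ys) ⟩
    sum (map F ys) * c + Cc * sum (map penalty ys)  ≡⟨ cong (λ z → sum (map F ys) * c + Cc * z) sum-penalty ⟩
    sum (map F ys) * c + Cc * (ℓ * E)               ≡⟨ cong (sum (map F ys) * c +_) (reorder Cc ℓ E) ⟩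
    sum (map F ys) * c + ℓ * Cc * E                 ∎
  where
  open ≤-Reasoning
  S = total ws
  ys = choiceSums ws
  ℓ = length ys
  Cc = M C c
  E = 2 * imbalance ws + 8
  F = λ y → M C (h ∸ y)
  penalty = λ y → 2 * ∣ S - 2 * y ∣ ² + 8
  pointwise : ∀ {y} → y ≤ S → Cc * c ≤ F y * c + Cc * penalty y
  pointwise {y} = C-deficit-at-shift M c h S y c-half h-half S≤h
  sum-penalty : sum (map penalty ys) ≡ ℓ * E
  sum-penalty = begin-equality
    sum (map penalty ys)                                                ≡⟨ sum-map-+ (λ y → 2 * ∣ S - 2 * y ∣ ²) (λ _ → 8) ys ⟩
    sum (map (λ y → 2 * ∣ S - 2 * y ∣ ²) ys) + sum (map (λ _ → 8) ys) ≡⟨ cong₂ _+_ (sum-map-*ˡ 2 (λ y → ∣ S - 2 * y ∣ ²) ys) (sum-map-const 8 ys) ⟩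
    2 * sum (map (λ y → ∣ S - 2 * y ∣ ²) ys) + ℓ * 8                   ≡⟨ cong (λ z → 2 * z + ℓ * 8) (sum-deviation² ws) ⟩
    2 * (ℓ * imbalance ws) + ℓ * 8                                      ≡⟨ factor ℓ (imbalance ws) ⟩
    ℓ * E                                                               ∎
    where
    factor : ∀ l d → 2 * (l * d) + l * 8 ≡ l * (2 * d + 8)
    factor = solve-∀
  reorder : ∀ b l e → b * (l * e) ≡ l * b * e
  reorder = solve-∀

-- Unimodality bounds the left sum by (M C c) per choice sum, while the central deficit,
-- summed by sum-deviation², bounds the right one below by (M C c)(1 - (2 imbalance + 8)/c) each.
choiceSums-ratio : ∀ m M c h ws → c IsHalfOf M → h IsHalfOf (M + total ws) → total ws ≤ h →
  suc (suc m) * (2 * imbalance ws + 8) ≤ c →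
  suc m * sum (map (λ y → M C (h ∸ y)) (choiceSums (unsplit ws)))
    ≤ suc (suc m) * sum (map (λ y → M C (h ∸ y)) (choiceSums ws))
choiceSums-ratio m M c h ws c-half h-half S≤h flat = *-cancelʳ-≤ _ _ c {{c≢0}} (begin
    suc m * Y * c                   ≤⟨ *-monoˡ-≤ c (*-monoʳ-≤ (suc m) Y≤) ⟩
    suc m * X * c                   ≤⟨ +-cancelʳ-≤ (X * c) _ _ (begin
      suc m * X * c + X * c           ≡⟨ gather m X c ⟩
      m2 * (X * c)                    ≤⟨ *-monoʳ-≤ m2 (sum-C-deficit M c h ws c-half h-half S≤h) ⟩
      m2 * (N * c + X * E)            ≡⟨ distribute m N c X E ⟩
      m2 * N * c + X * (m2 * E)       ≤⟨ +-monoʳ-≤ (m2 * N * c) (*-monoʳ-≤ X flat) ⟩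
      m2 * N * c + X * c              ∎) ⟩
    m2 * N * c                      ∎)
  where
  open ≤-Reasoning
  m2 = suc (suc m)
  F = λ y → M C (h ∸ y)
  ℓ = length (choiceSums ws)
  X = ℓ * (M C c)
  E = 2 * imbalance ws + 8
  Y = sum (map F (choiceSums (unsplit ws)))
  N = sum (map F (choiceSums ws))
  c≢0 : NonZero c
  c≢0 = >-nonZero (≤-trans (s≤s z≤n) (≤-trans (m≤n+m 8 (2 * imbalance ws)) (≤-trans (m≤n*m E m2) flat)))
  same-length : length (choiceSums (unsplit ws)) ≡ ℓ
  same-length = trans (length-choiceSums (unsplit ws)) (trans (cong (2 ^_) (length-unsplit ws)) (sym (length-choiceSums ws)))
  Y≤ : Y ≤ X
  Y≤ = subst (λ l → Y ≤ l * (M C c)) same-length (sum-C-≤-middle M c h c-half (choiceSums (unsplit ws)))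
  gather : ∀ m X c → suc m * X * c + X * c ≡ suc (suc m) * (X * c)
  gather = solve-∀
  distribute : ∀ m N c X E → suc (suc m) * (N * c + X * E) ≡ suc (suc m) * N * c + X * (suc (suc m) * E)
  distribute = solve-∀

module _ {A : Set} where

  private
    remove : ∀ {x : A} (xs : List A) → x ∈ xs → List A
    remove (_ ∷ xs) (here _) = xs
    remove (y ∷ xs) (there x∈) = y ∷ remove xs x∈

    length-remove : ∀ {x : A} (xs : List A) (x∈ : x ∈ xs) → suc (length (remove xs x∈)) ≡ length xs
    length-remove (_ ∷ xs) (here _) = refl
    length-remove (_ ∷ xs) (there x∈) = cong suc (length-remove xs x∈)

    ∈-remove : ∀ {x z : A} (xs : List A) (x∈ : x ∈ xs) → z ∈ xs → x ≢ z → z ∈ remove xs x∈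
    ∈-remove (_ ∷ xs) (here refl) (here refl) x≢z = ⊥-elim (x≢z refl)
    ∈-remove (_ ∷ xs) (here refl) (there z∈) x≢z = z∈
    ∈-remove (_ ∷ xs) (there x∈) (here refl) x≢z = here refl
    ∈-remove (_ ∷ xs) (there x∈) (there z∈) x≢z = there (∈-remove xs x∈ z∈ x≢z)

  Unique-⊆⇒length≤ : ∀ (xs ys : List A) → Unique xs → All (_∈ ys) xs → length xs ≤ length ys
  Unique-⊆⇒length≤ [] ys _ _ = z≤n
  Unique-⊆⇒length≤ (x ∷ xs) ys (x∉xs ∷ u) (x∈ys ∷ xs⊆ys) = begin
    suc (length xs)                  ≤⟨ s≤s (Unique-⊆⇒length≤ xs _ u (All.zipWith (λ (x≢ , z∈) → ∈-remove ys x∈ys z∈ x≢) (x∉xs , xs⊆ys))) ⟩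
    suc (length (remove ys x∈ys))    ≡⟨ length-remove ys x∈ys ⟩
    length ys                        ∎
    where open ≤-Reasoning

  Unique-map⁺-on : ∀ {B : Set} {P : A → Set} (f : A → B) → (∀ {x y} → P x → P y → f x ≡ f y → x ≡ y) →
    ∀ {xs} → All P xs → Unique xs → Unique (map f xs)
  Unique-map⁺-on f inj [] [] = []
  Unique-map⁺-on f inj (px ∷ pxs) (x∉ ∷ u) =
    All.map⁺ (All.zipWith (λ (py , x≢y) fx≡fy → x≢y (inj px py fx≡fy)) (pxs , x∉)) ∷ Unique-map⁺-on f inj pxs u

pick : ℕ × ℕ → Bool → ℕ
pick (p , q) true = p
pick (p , q) false = q

weight : Weights → List Bool → ℕ
weight (w ∷ ws) (b ∷ bs) = pick w b + weight ws bs
weight _ _ = 0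

HasWeight : Weights → ℕ → List Bool → Set
HasWeight ws h b = length b ≡ length ws × weight ws b ≡ h

words : Weights → ℕ → List (List Bool)
wordsStarting : Bool → ℕ → Weights → ℕ → List (List Bool)

words [] zero = [] ∷ []
words [] (suc h) = []
words ((p , q) ∷ ws) h = wordsStarting true p ws h ++ wordsStarting false q ws h

wordsStarting b w ws h with w ≤? h
... | yes _ = map (b ∷_) (words ws (h ∸ w))
... | no _ = []

wordsStarting-elim : ∀ (P : List (List Bool) → Set) b w ws h →
  P [] → (w ≤ h → P (map (b ∷_) (words ws (h ∸ w)))) → P (wordsStarting b w ws h)
wordsStarting-elim P b w ws h P[] P-fits with w ≤? h
... | yes w≤h = P-fits w≤h
... | no _ = P[]

∈-wordsStarting : ∀ {b w ws h v} → w ≤ h → v ∈ words ws (h ∸ w) → b ∷ v ∈ wordsStarting b w ws h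
∈-wordsStarting {b} {w} {ws} {h} w≤h v∈ with w ≤? h
... | yes _ = ∈.∈-map⁺ (b ∷_) v∈
... | no w≰h = ⊥-elim (w≰h w≤h)

words-sound : ∀ ws h → All (HasWeight ws h) (words ws h)
words-sound [] zero = (refl , refl) ∷ []
words-sound [] (suc h) = []
words-sound ((p , q) ∷ ws) h = All.++⁺ (starting true p (λ _ → refl)) (starting false q (λ _ → refl))
  where
  starting : ∀ b w → (∀ v → weight ((p , q) ∷ ws) (b ∷ v) ≡ w + weight ws v) →
    All (HasWeight ((p , q) ∷ ws) h) (wordsStarting b w ws h)
  starting b w head-weight = wordsStarting-elim (All (HasWeight ((p , q) ∷ ws) h)) b w ws h []
    (λ w≤h → All.map⁺ (All.map (λ {v} (len , wt) → cong suc len , trans (head-weight v) (trans (cong (w +_) wt) (m+[n∸m]≡n w≤h)))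
      (words-sound ws (h ∸ w))))

words-complete : ∀ ws h b → HasWeight ws h b → b ∈ words ws h
words-complete [] zero [] _ = here refl
words-complete ((p , q) ∷ ws) h (true ∷ b) (len , refl) =
  ∈.∈-++⁺ˡ (∈-wordsStarting (m≤m+n p (weight ws b))
    (words-complete ws _ b (suc-injective len , sym (m+n∸m≡n p (weight ws b)))))
words-complete ((p , q) ∷ ws) h (false ∷ b) (len , refl) =
  ∈.∈-++⁺ʳ _ (∈-wordsStarting (m≤m+n q (weight ws b))
    (words-complete ws _ b (suc-injective len , sym (m+n∸m≡n q (weight ws b)))))

words-unique : ∀ ws h → Unique (words ws h)
words-unique [] zero = [] ∷ []
words-unique [] (suc h) = []
words-unique ((p , q) ∷ ws) h = Unique.++⁺ (starting true p) (starting false q)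
  (λ (v∈t , v∈f) → true≢false (trans (sym (head-of {true} {p} v∈t)) (head-of {false} {q} v∈f)))
  where
  starting : ∀ b w → Unique (wordsStarting b w ws h)
  starting b w = wordsStarting-elim Unique b w ws h []
    (λ _ → Unique.map⁺ ∷-injectiveʳ (words-unique ws (h ∸ w)))
  head : List Bool → Bool
  head [] = false
  head (b ∷ _) = b
  head-of : ∀ {b w v} → v ∈ wordsStarting b w ws h → head v ≡ b
  head-of {b} {w} {v} v∈ = All.lookup (wordsStarting-elim (All (λ v → head v ≡ b)) b w ws h []
    (λ _ → All.map⁺ (All.universal (λ _ → refl) _))) v∈
  true≢false : true ≢ false
  true≢false ()

weight-++ : ∀ ws₁ ws₂ b₁ b₂ → length b₁ ≡ length ws₁ → weight (ws₁ ++ ws₂) (b₁ ++ b₂) ≡ weight ws₁ b₁ + weight ws₂ b₂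
weight-++ [] ws₂ [] b₂ _ = refl
weight-++ (w ∷ ws₁) ws₂ (b ∷ b₁) b₂ len =
  trans (cong (pick w b +_) (weight-++ ws₁ ws₂ b₁ b₂ (suc-injective len))) (sym (+-assoc (pick w b) _ _))

weight-map : ∀ {A : Set} (w : A → ℕ × ℕ) (g : A → Bool) xs → weight (map w xs) (map g xs) ≡ sum (map (λ x → pick (w x) (g x)) xs)
weight-map w g [] = refl
weight-map w g (x ∷ xs) = cong (pick (w x) (g x) +_) (weight-map w g xs)

ones : ℕ → Weights
ones M = replicate M (1 , 0)

weight-ones : ∀ {A : Set} (g : A → Bool) xs → weight (ones (length xs)) (map g xs) ≡ sum (map (𝟙 ∘ g) xs)
weight-ones g [] = refl
weight-ones g (x ∷ xs) with g x
... | true = cong suc (weight-ones g xs)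
... | false = weight-ones g xs

length-words-ones : ∀ M h → length (words (ones M) h) ≡ M C h
length-words-ones zero zero = refl
length-words-ones zero (suc h) = refl
length-words-ones (suc M) zero = begin
  length (words (ones (suc M)) 0)     ≡⟨ length-map (false ∷_) (words (ones M) 0) ⟩
  length (words (ones M) 0)           ≡⟨ length-words-ones M 0 ⟩
  1                                   ∎
  where open ≡-Reasoning
length-words-ones (suc M) (suc h) = begin
  length (map (true ∷_) (words (ones M) h) ++ map (false ∷_) (words (ones M) (suc h)))
    ≡⟨ length-++ (map (true ∷_) (words (ones M) h)) ⟩
  length (map (true ∷_) (words (ones M) h)) + length (map (false ∷_) (words (ones M) (suc h)))
    ≡⟨ cong₂ _+_ (length-map (true ∷_) (words (ones M) h)) (length-map (false ∷_) (words (ones M) (suc h))) ⟩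
  length (words (ones M) h) + length (words (ones M) (suc h))
    ≡⟨ cong₂ _+_ (length-words-ones M h) (length-words-ones M (suc h)) ⟩
  M C h + M C suc h
    ≡⟨ pascal M h ⟨
  suc M C suc h ∎
  where open ≡-Reasoning

-- Number of ways to complete a weight y to exactly h with M free unit weights (zero if y > h).
fillings : ℕ → ℕ → ℕ → ℕ
fillings M h y with y ≤? h
... | yes _ = M C (h ∸ y)
... | no _ = 0

fillings-≤ : ∀ M h y → y ≤ h → fillings M h y ≡ M C (h ∸ y)
fillings-≤ M h y y≤h with y ≤? h
... | yes _ = refl
... | no y≰h = ⊥-elim (y≰h y≤h)

private
  fillings-shift : ∀ M w h y → w ≤ h → fillings M (h ∸ w) y ≡ fillings M h (w + y)
  fillings-shift M w h y w≤h with y ≤? h ∸ w | w + y ≤? h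
  ... | yes _ | yes _ = cong (M C_) (∸-+-assoc h w y)
  ... | yes y≤ | no ≰h = ⊥-elim (≰h (subst (_≤ h) (+-comm y w) (m≤o∸n⇒m+n≤o y w≤h y≤)))
  ... | no y≰ | yes ≤h = ⊥-elim (y≰ (m+n≤o⇒m≤o∸n y (subst (_≤ h) (+-comm w y) ≤h)))
  ... | no _ | no _ = refl

  fillings-over : ∀ M w h y → ¬ (w ≤ h) → fillings M h (w + y) ≡ 0
  fillings-over M w h y w≰h with w + y ≤? h
  ... | yes ≤h = ⊥-elim (w≰h (≤-trans (m≤m+n w y) ≤h))
  ... | no _ = refl

  length-wordsStarting : ∀ M b w ws h →
    (∀ h → length (words (ws ++ ones M) h) ≡ sum (map (fillings M h) (choiceSums ws))) →
    length (wordsStarting b w (ws ++ ones M) h) ≡ sum (map (λ y → fillings M h (w + y)) (choiceSums ws))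
  length-wordsStarting M b w ws h IH with w ≤? h
  ... | yes w≤h = trans (length-map (b ∷_) (words (ws ++ ones M) (h ∸ w)))
        (trans (IH (h ∸ w)) (sum-map-cong (λ y → fillings-shift M w h y w≤h) (choiceSums ws)))
  ... | no w≰h = sym (trans (sum-map-cong (λ y → fillings-over M w h y w≰h) (choiceSums ws))
        (trans (sum-map-const 0 (choiceSums ws)) (*-zeroʳ (length (choiceSums ws)))))

length-words : ∀ M ws h → length (words (ws ++ ones M) h) ≡ sum (map (fillings M h) (choiceSums ws))
length-words M [] h = trans (length-words-ones M h) (sym (trans (+-identityʳ _) (fillings-≤ M h 0 z≤n)))
length-words M ((p , q) ∷ ws) h = begin
    length (wordsStarting true p (ws ++ ones M) h ++ wordsStarting false q (ws ++ ones M) h)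
      ≡⟨ length-++ (wordsStarting true p (ws ++ ones M) h) ⟩
    length (wordsStarting true p (ws ++ ones M) h) + length (wordsStarting false q (ws ++ ones M) h)
      ≡⟨ cong₂ _+_ (length-wordsStarting M true p ws h (length-words M ws)) (length-wordsStarting M false q ws h (length-words M ws)) ⟩
    sum (map (λ y → fillings M h (p + y)) ys) + sum (map (λ y → fillings M h (q + y)) ys)
      ≡⟨ cong₂ _+_ (cong sum (map-∘ ys)) (cong sum (map-∘ ys)) ⟩
    sum (map (fillings M h) (map (p +_) ys)) + sum (map (fillings M h) (map (q +_) ys))
      ≡⟨ sum-map-++ (fillings M h) (map (p +_) ys) _ ⟨
    sum (map (fillings M h) (choiceSums ((p , q) ∷ ws))) ∎
  where
  open ≡-Reasoning
  ys = choiceSums ws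

length-words-≤-total : ∀ M ws h → total ws ≤ h →
  length (words (ws ++ ones M) h) ≡ sum (map (λ y → M C (h ∸ y)) (choiceSums ws))
length-words-≤-total M ws h S≤h = trans (length-words M ws h)
  (sum-map-cong-local (All.map (λ y≤S → fillings-≤ M h _ (≤-trans y≤S S≤h)) (choiceSums-≤-total ws)))

∑-δ : ∀ n (a : Fin n) (Z : Fin n → ℕ) → (∑[ r < n ] (⟦ a Fin.≟ r ⟧ * Z r)) ≡ Z a
∑-δ (suc n) Fin.zero Z = begin
    1 * Z Fin.zero + (∑[ r < n ] (⟦ Fin.zero Fin.≟ Fin.suc r ⟧ * Z (Fin.suc r)))
      ≡⟨ cong (1 * Z Fin.zero +_) (sum-cong-≗ (λ r → cong (_* Z (Fin.suc r)) (⟦⟧-no (Fin.zero Fin.≟ Fin.suc r) (λ ())))) ⟩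
    1 * Z Fin.zero + (∑[ r < n ] 0)
      ≡⟨ cong (1 * Z Fin.zero +_) (sum-replicate-zero n) ⟩
    1 * Z Fin.zero + 0
      ≡⟨ trans (+-identityʳ _) (*-identityˡ _) ⟩
    Z Fin.zero ∎
  where open ≡-Reasoning
∑-δ (suc n) (Fin.suc a) Z = begin
    0 * Z Fin.zero + (∑[ r < n ] (⟦ Fin.suc a Fin.≟ Fin.suc r ⟧ * Z (Fin.suc r)))
      ≡⟨ sum-cong-≗ (λ r → cong (_* Z (Fin.suc r)) (suc-≟ r)) ⟩
    (∑[ r < n ] (⟦ a Fin.≟ r ⟧ * Z (Fin.suc r)))
      ≡⟨ ∑-δ n a (Z ∘ Fin.suc) ⟩
    Z (Fin.suc a) ∎
  where
  open ≡-Reasoning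
  suc-≟ : ∀ (r : Fin n) → ⟦ Fin.suc a Fin.≟ Fin.suc r ⟧ ≡ ⟦ a Fin.≟ r ⟧
  suc-≟ r with a Fin.≟ r
  ... | yes _ = refl
  ... | no _ = refl

∑-1 : ∀ n → (∑[ i < n ] 1) ≡ n
∑-1 zero = refl
∑-1 (suc n) = cong suc (∑-1 n)

∣tabulate∣ : ∀ n (g : Fin n → Bool) → ∣ Vec.tabulate g ∣ ≡ (∑[ i < n ] 𝟙 (g i))
∣tabulate∣ zero g = refl
∣tabulate∣ (suc n) g with g Fin.zero
... | true = cong suc (∣tabulate∣ n (g ∘ Fin.suc))
... | false = ∣tabulate∣ n (g ∘ Fin.suc)

module _ {A : Set} where

  sum-map-tabulate : ∀ n (h : A → ℕ) (f : Fin n → A) → sum (map h (tabulate f)) ≡ (∑[ i < n ] h (f i))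
  sum-map-tabulate zero h f = refl
  sum-map-tabulate (suc n) h f = cong (h (f Fin.zero) +_) (sum-map-tabulate n h (f ∘ Fin.suc))

  sum-map-filter : ∀ {P : A → Set} (P? : Decidable P) (h : A → ℕ) xs →
    sum (map h (filter P? xs)) ≡ sum (map (λ x → ⟦ P? x ⟧ * h x) xs)
  sum-map-filter P? h [] = refl
  sum-map-filter P? h (x ∷ xs) with P? x
  ... | yes _ = cong₂ _+_ (sym (+-identityʳ (h x))) (sum-map-filter P? h xs)
  ... | no _ = sum-map-filter P? h xs

  length-filter : ∀ {P : A → Set} (P? : Decidable P) xs → length (filter P? xs) ≡ sum (map (λ x → ⟦ P? x ⟧) xs)
  length-filter P? [] = refl
  length-filter P? (x ∷ xs) with P? x
  ... | yes _ = cong suc (length-filter P? xs)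
  ... | no _ = length-filter P? xs

Minimal : (ℕ → Set) → ℕ → Set
Minimal P m = P m × (∀ j → j < m → ¬ P j)

minimal : ∀ {P : ℕ → Set} → Decidable P → ∀ k → P k → ∃ (Minimal P)
minimal {P} P? = <-rec (λ k → P k → ∃ (Minimal P)) search
  where
  search : ∀ k → (∀ {j} → j < k → P j → ∃ (Minimal P)) → P k → ∃ (Minimal P)
  search k below pk with anyUpTo? P? k
  ... | yes (j , j<k , pj) = below j<k pj
  ... | no none = k , pk , λ j j<k pj → none (j , j<k , pj)

lookupAt : ∀ {m} → List (Fin m) → List Bool → Fin m → Bool
lookupAt [] _ y = false
lookupAt (p ∷ ps) [] y = false
lookupAt (p ∷ ps) (c ∷ cs) y with y Fin.≟ p
... | yes _ = c
... | no _ = lookupAt ps cs y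

lookupAt-map : ∀ {m} ps (g : Fin m → Bool) y → y ∈ ps → lookupAt ps (map g ps) y ≡ g y
lookupAt-map (p ∷ ps) g y y∈ with y Fin.≟ p | y∈
... | yes y≡p | _ = cong g (sym y≡p)
... | no y≢p | here y≡p = ⊥-elim (y≢p y≡p)
... | no _ | there y∈ps = lookupAt-map ps g y y∈ps

map-lookupAt : ∀ {m} (ps : List (Fin m)) b → Unique ps → length b ≡ length ps → map (lookupAt ps b) ps ≡ b
map-lookupAt [] [] _ _ = refl
map-lookupAt (p ∷ ps) (c ∷ cs) (p∉ps ∷ u) len = cong₂ _∷_ at-head
  (trans (map-cong-local (All.map (λ {y} p≢y → at-tail y (p≢y ∘ sym)) p∉ps)) (map-lookupAt ps cs u (suc-injective len)))
  where
  at-head : lookupAt (p ∷ ps) (c ∷ cs) p ≡ c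
  at-head with p Fin.≟ p
  ... | yes _ = refl
  ... | no p≢p = ⊥-elim (p≢p refl)
  at-tail : ∀ y → y ≢ p → lookupAt (p ∷ ps) (c ∷ cs) y ≡ lookupAt ps cs y
  at-tail y y≢p with y Fin.≟ p
  ... | yes y≡p = ⊥-elim (y≢p y≡p)
  ... | no _ = refl

module Components {n t : ℕ} (v : Fin t → Resp n) where
  open Graph v

  occurs? : ∀ x r → Dec (Occurs x r)
  occurs? x (vert y) with x Fin.≟ y
  ... | yes refl = yes in-vert
  ... | no x≢y = no λ { in-vert → x≢y refl }
  occurs? x (pair a b) with x Fin.≟ a | x Fin.≟ b
  ... | yes refl | _ = yes (in-fst b)
  ... | no _ | yes refl = yes (in-snd a)
  ... | no x≢a | no x≢b = no λ { (in-fst _) → x≢a refl ; (in-snd _) → x≢b refl }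
  occurs? x empty = no λ ()

  V? : Decidable V
  V? x = Fin.any? (λ i → occurs? x (v i))

  ≡pair? : ∀ (r : Resp n) a b → Dec (r ≡ pair a b)
  ≡pair? (vert _) a b = no λ ()
  ≡pair? empty a b = no λ ()
  ≡pair? (pair c d) a b with c Fin.≟ a | d Fin.≟ b
  ... | yes refl | yes refl = yes refl
  ... | no c≢a | _ = no λ { refl → c≢a refl }
  ... | _ | no d≢b = no λ { refl → d≢b refl }

  Adj? : ∀ x y → Dec (Adj x y)
  Adj? x y = Fin.any? (λ i → ≡pair? (v i) x y ⊎-dec ≡pair? (v i) y x)

  Adj-sym : ∀ {x y} → Adj x y → Adj y x
  Adj-sym (i , inj₁ e) = i , inj₂ e
  Adj-sym (i , inj₂ e) = i , inj₁ e

  Adj⇒V : ∀ {x y} → Adj x y → V x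
  Adj⇒V {x} {y} (i , inj₁ e) = i , subst (Occurs x) (sym e) (in-fst y)
  Adj⇒V {x} {y} (i , inj₂ e) = i , subst (Occurs x) (sym e) (in-snd y)

  Walk? : ∀ x y k → Dec (Walk x y k)
  Walk? x y zero with x Fin.≟ y
  ... | yes refl = yes here
  ... | no x≢y = no λ { here → x≢y refl }
  Walk? x y (suc k) = map′ (λ (z , a , w) → step a w) first-step (Fin.any? (λ z → Adj? x z ×-dec Walk? z y k))
    where
    first-step : Walk x y (suc k) → ∃ λ z → Adj x z × Walk z y k
    first-step (step a w) = _ , a , w

  snoc : ∀ {x y z k} → Walk x y k → Adj y z → Walk x z (suc k)
  snoc here a = step a here
  snoc (step b w) a = step b (snoc w a)

  reverse : ∀ {x y k} → Walk x y k → Walk y x k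
  reverse here = here
  reverse (step a w) = snoc (reverse w) (Adj-sym a)

  _++ʷ_ : ∀ {x y z k j} → Walk x y k → Walk y z j → Walk x z (k + j)
  here ++ʷ w' = w'
  step a w ++ʷ w' = step a (w ++ʷ w')

  Reach-refl : ∀ x → Reach x x
  Reach-refl x = 0 , here

  Reach-sym : ∀ {x y} → Reach x y → Reach y x
  Reach-sym (k , w) = k , reverse w

  Reach-trans : ∀ {x y z} → Reach x y → Reach y z → Reach x z
  Reach-trans (k , w) (j , w') = k + j , w ++ʷ w'

  Reach-V : ∀ {x y} → Reach x y → V x → V y
  Reach-V (zero , here) vx = vx
  Reach-V (suc k , w) _ = end-V w
    where
    end-V : ∀ {x y k} → Walk x y (suc k) → V y
    end-V (step a here) = Adj⇒V (Adj-sym a)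
    end-V (step a (step b w)) = end-V (step b w)

  vertices : ∀ {x y k} → Walk x y k → List (Fin n)
  vertices {x} here = x ∷ []
  vertices {x} (step a w) = x ∷ vertices w

  length-vertices : ∀ {x y k} (w : Walk x y k) → length (vertices w) ≡ suc k
  length-vertices here = refl
  length-vertices (step a w) = cong suc (length-vertices w)

  ∈vertices⇒Walk : ∀ {x y z k} (w : Walk x y k) → z ∈ vertices w → ∃ λ j → j ≤ k × Walk z y j
  ∈vertices⇒Walk here (here refl) = 0 , z≤n , here
  ∈vertices⇒Walk (step a w) (here refl) = _ , ≤-refl , step a w
  ∈vertices⇒Walk (step a w) (there z∈) with ∈vertices⇒Walk w z∈
  ... | j , j≤k , w' = j , m≤n⇒m≤1+n j≤k , w'

  shortest-Unique : ∀ {x y k} (w : Walk x y k) → (∀ j → j < k → ¬ Walk x y j) → Unique (vertices w)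
  shortest-Unique here _ = [] ∷ []
  shortest-Unique {x} (step a w) shortest =
    All.tabulate (λ z∈ x≡z → x∉ (subst (_∈ vertices w) (sym x≡z) z∈))
    ∷ shortest-Unique w (λ j j<k w' → shortest (suc j) (s≤s j<k) (step a w'))
    where
    x∉ : ¬ (x ∈ vertices w)
    x∉ x∈ with ∈vertices⇒Walk w x∈
    ... | j , j≤k , w' = shortest j (s≤s j≤k) w'

  shortest-length : ∀ {x y k} → Walk x y k → ∃ λ j → j < n × Walk x y j
  shortest-length {x} {y} {k} w with minimal (Walk? x y) k w
  ... | j , wj , shortest = j , subst (_≤ n) (length-vertices wj)
      (≤-trans (Unique-⊆⇒length≤ (vertices wj) (allFin n) (shortest-Unique wj shortest) (All.tabulate (λ {z} _ → ∈.∈-allFin z)))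
               (≤-reflexive (length-tabulate {n = n} (λ i → i))))
      , wj

  Reach? : ∀ x y → Dec (Reach x y)
  Reach? x y = map′ (λ (i , w) → toℕ i , w) bounded (Fin.any? (λ (i : Fin n) → Walk? x y (toℕ i)))
    where
    bounded : Reach x y → ∃ λ (i : Fin n) → Walk x y (toℕ i)
    bounded (k , w) with shortest-length w
    ... | j , j<n , w' = fromℕ< j<n , subst (Walk x y) (sym (Fin.toℕ-fromℕ< j<n)) w'

  least-vertex : (Q : Fin n → Set) → Decidable Q → ∀ y → Q y → Σ (Fin n) λ z → Q z × (∀ w → Q w → toℕ z ≤ toℕ w)
  least-vertex Q Q? y qy with minimal P? (toℕ y) (y , refl , qy)
    where
    P : ℕ → Set
    P k = ∃ λ z → toℕ z ≡ k × Q z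
    P? : Decidable P
    P? k = Fin.any? (λ z → (toℕ z ≟ k) ×-dec Q? z)
  ... | _ , (z , refl , qz) , least = z , qz , λ w qw → ≮⇒≥ (λ w<z → least (toℕ w) w<z (w , refl , qw))

  private
    root-spec : ∀ y → Σ (Fin n) λ z → Reach y z × (∀ w → Reach y w → toℕ z ≤ toℕ w)
    root-spec y = least-vertex (Reach y) (Reach? y) y (Reach-refl y)

  root : Fin n → Fin n
  root y = proj₁ (root-spec y)

  Reach-root : ∀ y → Reach y (root y)
  Reach-root y = proj₁ (proj₂ (root-spec y))

  root-least : ∀ y w → Reach y w → toℕ (root y) ≤ toℕ w
  root-least y = proj₂ (proj₂ (root-spec y))

  IsRoot-root : ∀ y → V y → IsRoot (root y)
  IsRoot-root y vy = Reach-V (Reach-root y) vy , λ w rw → root-least y w (Reach-trans (Reach-root y) rw)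

  IsRoot⇒root≡ : ∀ r y → IsRoot r → Reach r y → root y ≡ r
  IsRoot⇒root≡ r y (_ , r-least) ry = Fin.toℕ-injective (≤-antisym
    (root-least y r (Reach-sym ry)) (r-least (root y) (Reach-trans ry (Reach-root y))))

  root-idem : ∀ y → root (root y) ≡ root y
  root-idem y = Fin.toℕ-injective (≤-antisym
    (root-least (root y) (root y) (Reach-refl _))
    (root-least y (root (root y)) (Reach-trans (Reach-root y) (Reach-root (root y)))))

  private
    dist-spec : ∀ y → ∃ (Dist (root y) y)
    dist-spec y with Reach-sym (Reach-root y)
    ... | k , w = minimal (Walk? (root y) y) k w

  dist : Fin n → ℕ
  dist y = proj₁ (dist-spec y)

  Dist-dist : ∀ y → Dist (root y) y (dist y)
  Dist-dist y = proj₂ (dist-spec y)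

  Dist-unique : ∀ {r y d d'} → Dist r y d → Dist r y d' → d ≡ d'
  Dist-unique {d = d} {d'} (w , shortest) (w' , shortest') with <-cmp d d'
  ... | tri< d<d' _ _ = ⊥-elim (shortest' d d<d' w)
  ... | tri≈ _ d≡d' _ = d≡d'
  ... | tri> _ _ d>d' = ⊥-elim (shortest d' d>d' w')

  odd-distance : Fin n → Bool
  odd-distance y = (dist y % 2) ≡ᵇ 1

  odd-distance-root : ∀ r → V r → root r ≡ r → odd-distance r ≡ false
  odd-distance-root r _ root≡r = cong (λ d → (d % 2) ≡ᵇ 1) dist≡0
    where
    dist≡0 : dist r ≡ 0
    dist≡0 = Dist-unique (subst (λ z → Dist z r (dist r)) root≡r (Dist-dist r)) (here , λ _ ())

  IsOwnRoot? : ∀ x → Dec (V x × root x ≡ x)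
  IsOwnRoot? x = V? x ×-dec (root x Fin.≟ x)

  roots free slots : List (Fin n)
  roots = filter IsOwnRoot? (allFin n)
  free = filter (¬? ∘ V?) (allFin n)
  slots = roots ++ free

  sum-roots : ∀ (f : Fin n → ℕ) → sum (map f roots) ≡ (∑[ r < n ] (⟦ IsOwnRoot? r ⟧ * f r))
  sum-roots f = trans (sum-map-filter IsOwnRoot? f (allFin n)) (sum-map-tabulate n _ (λ i → i))

  sum-free : ∀ (f : Fin n → ℕ) → sum (map f free) ≡ (∑[ y < n ] (⟦ ¬? (V? y) ⟧ * f y))
  sum-free f = trans (sum-map-filter (¬? ∘ V?) f (allFin n)) (sum-map-tabulate n _ (λ i → i))

  slots-Unique : Unique slots
  slots-Unique = Unique.++⁺ (Unique.filter⁺ IsOwnRoot? (Unique.allFin⁺ n)) (Unique.filter⁺ (¬? ∘ V?) (Unique.allFin⁺ n))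
    (λ (∈roots , ∈free) → proj₂ (∈.∈-filter⁻ (¬? ∘ V?) {xs = allFin n} ∈free) (proj₁ (proj₂ (∈.∈-filter⁻ IsOwnRoot? {xs = allFin n} ∈roots))))

  root∈slots : ∀ y → V y → root y ∈ slots
  root∈slots y vy = ∈.∈-++⁺ˡ (∈.∈-filter⁺ IsOwnRoot? (∈.∈-allFin _) (Reach-V (Reach-root y) vy , root-idem y))

  free∈slots : ∀ y → ¬ V y → y ∈ slots
  free∈slots y ¬vy = ∈.∈-++⁺ʳ roots (∈.∈-filter⁺ (¬? ∘ V?) (∈.∈-allFin _) ¬vy)

  bit : Subset n → Fin n → Bool
  bit A y = Vec.lookup A y

  bit-∈ : ∀ {A y} → y ∈ˢ A → bit A y ≡ true
  bit-∈ = Vec.[]=⇒lookup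

  bit-∉ : ∀ {A y} → y ∉ˢ A → bit A y ≡ false
  bit-∉ {A} {y} y∉A with bit A y in eq
  ... | true = ⊥-elim (y∉A (Vec.lookup⇒[]= y A eq))
  ... | false = refl

  true⇒∈ : ∀ {A y} → bit A y ≡ true → y ∈ˢ A
  true⇒∈ {A} {y} = Vec.lookup⇒[]= y A

  false⇒∉ : ∀ {A y} → bit A y ≡ false → y ∉ˢ A
  false⇒∉ eq y∈A with trans (sym eq) (bit-∈ y∈A)
  ... | ()

  member : Fin n → Fin n → ℕ
  member r y = ⟦ V? y ⟧ * ⟦ root y Fin.≟ r ⟧

  sum-by-component : ∀ (X : Fin n → Fin n → ℕ) →
    (∑[ r < n ] (⟦ IsOwnRoot? r ⟧ * (∑[ y < n ] (member r y * X r y)))) ≡ (∑[ y < n ] (⟦ V? y ⟧ * X (root y) y))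
  sum-by-component X = begin
      (∑[ r < n ] (⟦ IsOwnRoot? r ⟧ * (∑[ y < n ] (member r y * X r y))))
        ≡⟨ sum-cong-≗ (λ r → *-distribˡ-sum ⟦ IsOwnRoot? r ⟧ (λ y → member r y * X r y)) ⟩
      (∑[ r < n ] (∑[ y < n ] (⟦ IsOwnRoot? r ⟧ * (member r y * X r y))))
        ≡⟨ ∑-comm (λ r y → ⟦ IsOwnRoot? r ⟧ * (member r y * X r y)) ⟩
      (∑[ y < n ] (∑[ r < n ] (⟦ IsOwnRoot? r ⟧ * (member r y * X r y))))
        ≡⟨ sum-cong-≗ picks-root ⟩
      (∑[ y < n ] (⟦ V? y ⟧ * X (root y) y)) ∎
    where
    open ≡-Reasoning
    reorder : ∀ a b c d → a * ((b * c) * d) ≡ c * (a * b * d)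
    reorder = solve-∀
    root-term : ∀ y → (d : Dec (V y)) → ⟦ IsOwnRoot? (root y) ⟧ * ⟦ d ⟧ * X (root y) y ≡ ⟦ d ⟧ * X (root y) y
    root-term y (yes vy) = cong (λ z → z * 1 * X (root y) y) (⟦⟧-yes (IsOwnRoot? (root y)) (Reach-V (Reach-root y) vy , root-idem y))
    root-term y (no _) = cong (_* X (root y) y) (*-zeroʳ ⟦ IsOwnRoot? (root y) ⟧)
    picks-root : ∀ y → (∑[ r < n ] (⟦ IsOwnRoot? r ⟧ * (member r y * X r y))) ≡ ⟦ V? y ⟧ * X (root y) y
    picks-root y = begin
      (∑[ r < n ] (⟦ IsOwnRoot? r ⟧ * (member r y * X r y)))
        ≡⟨ sum-cong-≗ (λ r → reorder ⟦ IsOwnRoot? r ⟧ ⟦ V? y ⟧ ⟦ root y Fin.≟ r ⟧ (X r y)) ⟩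
      (∑[ r < n ] (⟦ root y Fin.≟ r ⟧ * (⟦ IsOwnRoot? r ⟧ * ⟦ V? y ⟧ * X r y)))
        ≡⟨ ∑-δ n (root y) (λ r → ⟦ IsOwnRoot? r ⟧ * ⟦ V? y ⟧ * X r y) ⟩
      ⟦ IsOwnRoot? (root y) ⟧ * ⟦ V? y ⟧ * X (root y) y
        ≡⟨ root-term y (V? y) ⟩
      ⟦ V? y ⟧ * X (root y) y ∎

  -- Sides relative to the root: a consistent A is fixed by its bits on roots and free vertices,
  -- and the component of r contributes the first or second block weight according to r ∈ A.
  module Encoding (side : Fin n → Bool) (side-root : ∀ r → V r → root r ≡ r → side r ≡ false) where

    Consistent : Subset n → Set
    Consistent A = ∀ y → V y → bit A y ≡ bit A (root y) xor side y

    decodeAt : List Bool → Fin n → Bool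
    decodeAt b y with V? y
    ... | yes _ = lookupAt slots b (root y) xor side y
    ... | no _ = lookupAt slots b y

    decodeAt-V : ∀ b y → V y → decodeAt b y ≡ lookupAt slots b (root y) xor side y
    decodeAt-V b y vy with V? y
    ... | yes _ = refl
    ... | no ¬vy = ⊥-elim (¬vy vy)

    decodeAt-¬V : ∀ b y → ¬ V y → decodeAt b y ≡ lookupAt slots b y
    decodeAt-¬V b y ¬vy with V? y
    ... | yes vy = ⊥-elim (¬vy vy)
    ... | no _ = refl

    decode : List Bool → Subset n
    decode b = Vec.tabulate (decodeAt b)

    encode : Subset n → List Bool
    encode A = map (bit A) slots

    bit-decode : ∀ b y → bit (decode b) y ≡ decodeAt b y
    bit-decode b y = Vec.lookup∘tabulate (decodeAt b) y

    decode-encode : ∀ A → Consistent A → decode (encode A) ≡ A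
    decode-encode A consistent = trans (Vec.tabulate-cong agrees) (Vec.tabulate∘lookup A)
      where
      agrees : ∀ y → decodeAt (encode A) y ≡ bit A y
      agrees y with V? y
      ... | yes vy = trans (cong (_xor side y) (lookupAt-map slots (bit A) (root y) (root∈slots y vy))) (sym (consistent y vy))
      ... | no ¬vy = lookupAt-map slots (bit A) y (free∈slots y ¬vy)

    encode-decode : ∀ b → length b ≡ length slots → encode (decode b) ≡ b
    encode-decode b len = trans (map-cong-local (All.tabulate agrees)) (map-lookupAt slots b slots-Unique len)
      where
      agrees : ∀ {y} → y ∈ slots → bit (decode b) y ≡ lookupAt slots b y
      agrees {y} y∈ with ∈.∈-++⁻ roots y∈
      ... | inj₁ y∈roots = let (vy , root≡y) = proj₂ (∈.∈-filter⁻ IsOwnRoot? {xs = allFin n} y∈roots) in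
            trans (bit-decode b y) (trans (decodeAt-V b y vy)
              (trans (cong₂ (λ a s → lookupAt slots b a xor s) root≡y (side-root y vy root≡y)) (xor-identityʳ _)))
      ... | inj₂ y∈free = trans (bit-decode b y) (decodeAt-¬V b y (proj₂ (∈.∈-filter⁻ (¬? ∘ V?) {xs = allFin n} y∈free)))

    decode-Consistent : ∀ b → Consistent (decode b)
    decode-Consistent b y vy = begin
        bit (decode b) y                                      ≡⟨ trans (bit-decode b y) (decodeAt-V b y vy) ⟩
        g (root y) xor side y                                 ≡⟨ cong (_xor side y) (xor-identityʳ (g (root y))) ⟨
        (g (root y) xor false) xor side y                     ≡⟨ cong (λ s → (g (root y) xor s) xor side y) (side-root (root y) vr (root-idem y)) ⟨
        (g (root y) xor side (root y)) xor side y             ≡⟨ cong (λ z → (g z xor side (root y)) xor side y) (root-idem y) ⟨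
        (g (root (root y)) xor side (root y)) xor side y      ≡⟨ cong (_xor side y) (trans (bit-decode b (root y)) (decodeAt-V b (root y) vr)) ⟨
        bit (decode b) (root y) xor side y                    ∎
      where
      open ≡-Reasoning
      g = lookupAt slots b
      free-part = ∑[ y < n ] (⟦ ¬? (V? y) ⟧ * 𝟙 (g y))
      vr = Reach-V (Reach-root y) vy

    blockWeight : Fin n → ℕ × ℕ
    blockWeight r = (∑[ y < n ] (member r y * 𝟙 (not (side y)))) , (∑[ y < n ] (member r y * 𝟙 (side y)))

    slotWeights : Weights
    slotWeights = map blockWeight roots ++ ones (length free)

    length-slotWeights : length slotWeights ≡ length slots
    length-slotWeights = trans (length-++ (map blockWeight roots))
      (trans (cong₂ _+_ (length-map blockWeight roots) (length-replicate (length free))) (sym (length-++ roots)))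

    private
      pick-blockWeight : ∀ r s → pick (blockWeight r) s ≡ (∑[ y < n ] (member r y * 𝟙 (s xor side y)))
      pick-blockWeight r true = refl
      pick-blockWeight r false = refl

      ∣decode∣-split : ∀ b → let g = lookupAt slots b in
        ∣ decode b ∣ ≡ (∑[ y < n ] (⟦ V? y ⟧ * 𝟙 (g (root y) xor side y))) + (∑[ y < n ] (⟦ ¬? (V? y) ⟧ * 𝟙 (g y)))
      ∣decode∣-split b = trans (∣tabulate∣ n (decodeAt b)) (trans (sum-cong-≗ {n} by-cases)
          (∑-distrib-+ (λ y → ⟦ V? y ⟧ * 𝟙 (g (root y) xor side y)) (λ y → ⟦ ¬? (V? y) ⟧ * 𝟙 (g y))))
        where
        g = lookupAt slots b
        by-cases : ∀ y → 𝟙 (decodeAt b y) ≡ ⟦ V? y ⟧ * 𝟙 (g (root y) xor side y) + ⟦ ¬? (V? y) ⟧ * 𝟙 (g y)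
        by-cases y with V? y
        ... | yes _ = sym (trans (+-identityʳ _) (+-identityʳ _))
        ... | no _ = sym (+-identityʳ _)

    ∣decode∣ : ∀ b → length b ≡ length slots → ∣ decode b ∣ ≡ weight slotWeights b
    ∣decode∣ b len = begin
        ∣ decode b ∣
          ≡⟨ ∣decode∣-split b ⟩
        (∑[ y < n ] (⟦ V? y ⟧ * 𝟙 (g (root y) xor side y))) + free-part
          ≡⟨ cong (_+ free-part) (sum-by-component (λ r y → 𝟙 (g r xor side y))) ⟨
        (∑[ r < n ] (⟦ IsOwnRoot? r ⟧ * (∑[ y < n ] (member r y * 𝟙 (g r xor side y))))) + free-part
          ≡⟨ cong₂ _+_ (trans (sum-cong-≗ (λ r → cong (⟦ IsOwnRoot? r ⟧ *_) (sym (pick-blockWeight r (g r))))) (sym (sum-roots _)))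
                       (sym (sum-free (𝟙 ∘ g))) ⟩
        sum (map (λ r → pick (blockWeight r) (g r)) roots) + sum (map (𝟙 ∘ g) free)
          ≡⟨ cong₂ _+_ (weight-map blockWeight g roots) (weight-ones g free) ⟨
        weight (map blockWeight roots) (map g roots) + weight (ones (length free)) (map g free)
          ≡⟨ weight-++ (map blockWeight roots) _ (map g roots) _ (trans (length-map g roots) (sym (length-map blockWeight roots))) ⟨
        weight slotWeights (map g roots ++ map g free)
          ≡⟨ cong (weight slotWeights) (trans (sym (map-++ g roots free)) (map-lookupAt slots b slots-Unique len)) ⟩
        weight slotWeights b ∎
      where
      open ≡-Reasoning
      g = lookupAt slots b
      free-part = ∑[ y < n ] (⟦ ¬? (V? y) ⟧ * 𝟙 (g y))

  module Yes = Encoding (λ _ → false) (λ _ _ _ → refl)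
  -- Vertices at odd distance from the root are those in the paper's even layers.
  module No = Encoding odd-distance odd-distance-root

  EYes⇒Consistent : ∀ A → EYes A → Yes.Consistent A
  EYes⇒Consistent A yes-event y vy with yes-event (root y) (IsRoot-root y vy)
  ... | inj₁ inside = trans (bit-∈ (inside y y∼root)) (sym (trans (xor-identityʳ _) (bit-∈ (inside (root y) (Reach-refl _)))))
    where y∼root = Reach-sym (Reach-root y)
  ... | inj₂ outside = trans (bit-∉ (outside y y∼root)) (sym (trans (xor-identityʳ _) (bit-∉ (outside (root y) (Reach-refl _)))))
    where y∼root = Reach-sym (Reach-root y)

  Consistent⇒ENo : ∀ A → No.Consistent A → ENo A
  Consistent⇒ENo A consistent r isRoot = by-root-bit (bit A r) refl
    where
    layer : ∀ y d → Dist r y d → bit A y ≡ bit A r xor ((d % 2) ≡ᵇ 1)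
    layer y d D = begin
        bit A y                                   ≡⟨ consistent y (Reach-V r∼y (proj₁ isRoot)) ⟩
        bit A (root y) xor odd-distance y         ≡⟨ cong₂ (λ z e → bit A z xor ((e % 2) ≡ᵇ 1)) root≡r dist≡d ⟩
        bit A r xor ((d % 2) ≡ᵇ 1)                ∎
      where
      open ≡-Reasoning
      r∼y : Reach r y
      r∼y = d , proj₁ D
      root≡r = IsRoot⇒root≡ r y isRoot r∼y
      dist≡d = Dist-unique (subst (λ z → Dist z y (dist y)) root≡r (Dist-dist y)) D
    by-root-bit : ∀ s → bit A r ≡ s →
      (∀ y d → Dist r y d → (Even d → y ∈ˢ A) × (Odd d → y ∉ˢ A)) ⊎ (∀ y d → Dist r y d → (Even d → y ∉ˢ A) × (Odd d → y ∈ˢ A))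
    by-root-bit true r∈ = inj₁ λ y d D →
        (λ even → true⇒∈ (trans (layer y d D) (cong₂ (λ s e → s xor (e ≡ᵇ 1)) r∈ even)))
      , (λ odd → false⇒∉ (trans (layer y d D) (cong₂ (λ s e → s xor (e ≡ᵇ 1)) r∈ odd)))
    by-root-bit false r∉ = inj₂ λ y d D →
        (λ even → false⇒∉ (trans (layer y d D) (cong₂ (λ s e → s xor (e ≡ᵇ 1)) r∉ even)))
      , (λ odd → true⇒∈ (trans (layer y d D) (cong₂ (λ s e → s xor (e ≡ᵇ 1)) r∉ odd)))

  private
    split-by-side : ∀ a s → a * 1 ≡ a * 𝟙 (not s) + a * 𝟙 s
    split-by-side a true = cong (_+ a * 1) (sym (*-zeroʳ a))
    split-by-side a false = sym (trans (cong (a * 1 +_) (*-zeroʳ a)) (+-identityʳ _))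

  componentSize : Fin n → ℕ
  componentSize r = ∑[ y < n ] (member r y * 1)

  No-blockWeight-total : ∀ r → proj₁ (No.blockWeight r) + proj₂ (No.blockWeight r) ≡ componentSize r
  No-blockWeight-total r = sym (trans (sum-cong-≗ {n} (λ y → split-by-side (member r y) (odd-distance y))) (∑-distrib-+ {n} _ _))

  Yes-blockWeights : ∀ rs → map Yes.blockWeight rs ≡ unsplit (map No.blockWeight rs)
  Yes-blockWeights [] = refl
  Yes-blockWeights (r ∷ rs) = cong₂ _∷_ (cong₂ _,_ (sym (No-blockWeight-total r)) nothing-flipped) (Yes-blockWeights rs)
    where
    nothing-flipped : (∑[ y < n ] (member r y * 0)) ≡ 0
    nothing-flipped = trans (sum-cong-≗ {n} (λ y → *-zeroʳ (member r y))) (sum-replicate-zero n)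

  #V : ℕ
  #V = ∑[ y < n ] ⟦ V? y ⟧

  total-No-blockWeights : total (map No.blockWeight roots) ≡ #V
  total-No-blockWeights = begin
      total (map No.blockWeight roots)                          ≡⟨ total-map No.blockWeight roots ⟩
      sum (map (λ r → proj₁ (No.blockWeight r) + proj₂ (No.blockWeight r)) roots)
                                                                ≡⟨ sum-map-cong No-blockWeight-total roots ⟩
      sum (map componentSize roots)                             ≡⟨ sum-roots componentSize ⟩
      (∑[ r < n ] (⟦ IsOwnRoot? r ⟧ * componentSize r))            ≡⟨ sum-by-component (λ _ _ → 1) ⟩
      (∑[ y < n ] (⟦ V? y ⟧ * 1))                               ≡⟨ sum-cong-≗ {n} (λ y → *-identityʳ _) ⟩
      #V                                                        ∎
    where open ≡-Reasoning

  #V+#free≡n : #V + length free ≡ n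
  #V+#free≡n = begin
      #V + length free                                          ≡⟨ cong (#V +_) (length-filter (¬? ∘ V?) (allFin n)) ⟩
      #V + sum (map (λ y → ⟦ ¬? (V? y) ⟧) (allFin n))          ≡⟨ cong (#V +_) (sum-map-tabulate n _ (λ i → i)) ⟩
      #V + (∑[ y < n ] ⟦ ¬? (V? y) ⟧)                           ≡⟨ ∑-distrib-+ {n} _ _ ⟨
      (∑[ y < n ] (⟦ V? y ⟧ + ⟦ ¬? (V? y) ⟧))                   ≡⟨ sum-cong-≗ {n} (λ y → ⟦⟧+⟦¬⟧≡1 (V? y)) ⟩
      (∑[ y < n ] 1)                                            ≡⟨ ∑-1 n ⟩
      n                                                         ∎
    where open ≡-Reasoning

  componentSize-≤ : ∀ L → (∀ x → V x → CompSizeAtMost L x) → ∀ r → r ∈ roots → componentSize r ≤ L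
  componentSize-≤ L small r r∈ = subst (_≤ L) length≡ (small r vr component (Unique.filter⁺ inComponent? (Unique.allFin⁺ n)) reachable)
    where
    vr = proj₁ (proj₂ (∈.∈-filter⁻ IsOwnRoot? {xs = allFin n} r∈))
    inComponent? : ∀ y → Dec (V y × root y ≡ r)
    inComponent? y = V? y ×-dec (root y Fin.≟ r)
    component = filter inComponent? (allFin n)
    reachable : All (Reach r) component
    reachable = All.tabulate (λ {y} y∈ → let (_ , root≡r) = proj₂ (∈.∈-filter⁻ inComponent? {xs = allFin n} y∈) in
      subst (λ z → Reach z y) root≡r (Reach-sym (Reach-root y)))
    length≡ : length component ≡ componentSize r
    length≡ = trans (length-filter inComponent? (allFin n)) (trans (sum-map-tabulate n _ (λ i → i))
      (sum-cong-≗ {n} (λ y → trans (⟦⟧-× (V? y) (root y Fin.≟ r)) (sym (*-identityʳ _)))))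

  imbalance-≤ : ∀ L → (∀ x → V x → CompSizeAtMost L x) → imbalance (map No.blockWeight roots) ≤ L * #V
  imbalance-≤ L small = begin
      imbalance (map No.blockWeight roots)            ≡⟨ imbalance-map No.blockWeight roots ⟩
      sum (map (λ r → ∣ p r - q r ∣ ²) roots)          ≤⟨ sum-map-mono roots (All.tabulate (λ {r} r∈ → square-≤ r (componentSize-≤ L small r r∈))) ⟩
      sum (map (λ r → L * (p r + q r)) roots)          ≡⟨ sum-map-*ˡ L _ roots ⟩
      L * sum (map (λ r → p r + q r) roots)            ≡⟨ cong (L *_) (trans (sym (total-map No.blockWeight roots)) total-No-blockWeights) ⟩
      L * #V                                           ∎
    where
    open ≤-Reasoning
    p = λ r → proj₁ (No.blockWeight r)
    q = λ r → proj₂ (No.blockWeight r)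
    square-≤ : ∀ r → componentSize r ≤ L → ∣ p r - q r ∣ ² ≤ L * (p r + q r)
    square-≤ r size≤ = *-mono-≤ (≤-trans ∣p-q∣≤p+q (≤-trans (≤-reflexive (No-blockWeight-total r)) size≤)) ∣p-q∣≤p+q
      where
      ∣p-q∣≤p+q : ∣ p r - q r ∣ ≤ p r + q r
      ∣p-q∣≤p+q = ≤-trans (∣m-n∣≤m⊔n (p r) (q r)) (m⊔n≤m+n (p r) (q r))

  occurrences : Resp n → List (Fin n)
  occurrences (vert x) = x ∷ []
  occurrences (pair a b) = a ∷ b ∷ []
  occurrences empty = []

  Occurs⇒∈ : ∀ {x r} → Occurs x r → x ∈ occurrences r
  Occurs⇒∈ in-vert = here refl
  Occurs⇒∈ (in-fst _) = here refl
  Occurs⇒∈ (in-snd _) = there (here refl)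

  length-occurrences : ∀ r → length (occurrences r) ≤ 2 * isNonEmpty r
  length-occurrences (vert x) = s≤s z≤n
  length-occurrences (pair a b) = ≤-refl
  length-occurrences empty = z≤n

  occurring : List (Fin t) → List (Fin n)
  occurring [] = []
  occurring (i ∷ is) = occurrences (v i) ++ occurring is

  ∈-occurring : ∀ {x i} is → i ∈ is → x ∈ occurrences (v i) → x ∈ occurring is
  ∈-occurring (_ ∷ is) (here refl) x∈ = ∈.∈-++⁺ˡ x∈
  ∈-occurring (j ∷ is) (there i∈) x∈ = ∈.∈-++⁺ʳ (occurrences (v j)) (∈-occurring is i∈ x∈)

  length-occurring : ∀ is → length (occurring is) ≤ 2 * sum (map (isNonEmpty ∘ v) is)
  length-occurring [] = z≤n
  length-occurring (i ∷ is) = begin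
    length (occurrences (v i) ++ occurring is)               ≡⟨ length-++ (occurrences (v i)) ⟩
    length (occurrences (v i)) + length (occurring is)       ≤⟨ +-mono-≤ (length-occurrences (v i)) (length-occurring is) ⟩
    2 * isNonEmpty (v i) + 2 * sum (map (isNonEmpty ∘ v) is) ≡⟨ *-distribˡ-+ 2 (isNonEmpty (v i)) _ ⟨
    2 * sum (map (isNonEmpty ∘ v) (i ∷ is))                  ∎
    where open ≤-Reasoning

  #V≤2*numNonEmpty : #V ≤ 2 * numNonEmpty
  #V≤2*numNonEmpty = begin
      #V                                         ≡⟨ trans (length-filter V? (allFin n)) (sum-map-tabulate n _ (λ i → i)) ⟨
      length (filter V? (allFin n))              ≤⟨ Unique-⊆⇒length≤ _ (occurring (allFin t)) (Unique.filter⁺ V? (Unique.allFin⁺ n))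
                                                      (All.tabulate occurs) ⟩
      length (occurring (allFin t))              ≤⟨ length-occurring (allFin t) ⟩
      2 * sum (map (isNonEmpty ∘ v) (allFin t))  ≡⟨ cong (λ z → 2 * sum z) (map-tabulate (λ i → i) (isNonEmpty ∘ v)) ⟩
      2 * numNonEmpty                            ∎
    where
    open ≤-Reasoning
    occurs : ∀ {x} → x ∈ filter V? (allFin n) → x ∈ occurring (allFin t)
    occurs x∈ = let (i , x-occurs) = proj₂ (∈.∈-filter⁻ V? {xs = allFin n} x∈) in
      ∈-occurring (allFin t) (∈.∈-allFin i) (Occurs⇒∈ x-occurs)

  blocks : Weights
  blocks = map No.blockWeight roots

  module _ (h : ℕ) where

    no-sets : #V ≤ h → ∃ λ Ln → Unique Ln × All (λ A → ∣ A ∣ ≡ h × ENo A) Ln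
      × length Ln ≡ sum (map (λ y → length free C (h ∸ y)) (choiceSums blocks))
    no-sets #V≤h = map No.decode (words No.slotWeights h) , unique , sound
      , trans (length-map No.decode (words No.slotWeights h))
              (length-words-≤-total (length free) blocks h (subst (_≤ h) (sym total-No-blockWeights) #V≤h))
      where
      injective : ∀ {b b'} → HasWeight No.slotWeights h b → HasWeight No.slotWeights h b' → No.decode b ≡ No.decode b' → b ≡ b'
      injective (len , _) (len' , _) eq = trans (sym (No.encode-decode _ (trans len No.length-slotWeights)))
        (trans (cong No.encode eq) (No.encode-decode _ (trans len' No.length-slotWeights)))
      unique : Unique (map No.decode (words No.slotWeights h))
      unique = Unique-map⁺-on No.decode injective (words-sound No.slotWeights h) (words-unique No.slotWeights h)
      decoded-ok : ∀ {b} → HasWeight No.slotWeights h b → ∣ No.decode b ∣ ≡ h × ENo (No.decode b)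
      decoded-ok {b} (len , wt) = trans (No.∣decode∣ b (trans len No.length-slotWeights)) wt , Consistent⇒ENo (No.decode b) (No.decode-Consistent b)
      sound : All (λ A → ∣ A ∣ ≡ h × ENo A) (map No.decode (words No.slotWeights h))
      sound = All.map⁺ (All.map decoded-ok (words-sound No.slotWeights h))

    yes-sets-length≤ : #V ≤ h → ∀ Ly → Unique Ly → All (λ A → ∣ A ∣ ≡ h × EYes A) Ly →
      length Ly ≤ sum (map (λ y → length free C (h ∸ y)) (choiceSums (unsplit blocks)))
    yes-sets-length≤ #V≤h Ly unique sound = begin
        length Ly                                          ≤⟨ Unique-⊆⇒length≤ Ly _ unique (All.map decoded sound) ⟩
        length (map Yes.decode (words Yes.slotWeights h))  ≡⟨ length-map Yes.decode (words Yes.slotWeights h) ⟩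
        length (words (map Yes.blockWeight roots ++ ones (length free)) h)
          ≡⟨ cong (λ ws → length (words (ws ++ ones (length free)) h)) (Yes-blockWeights roots) ⟩
        length (words (unsplit blocks ++ ones (length free)) h)
          ≡⟨ length-words-≤-total (length free) (unsplit blocks) h total≤h ⟩
        sum (map (λ y → length free C (h ∸ y)) (choiceSums (unsplit blocks))) ∎
      where
      open ≤-Reasoning
      total≤h : total (unsplit blocks) ≤ h
      total≤h = subst (_≤ h) (sym (trans (total-unsplit blocks) total-No-blockWeights)) #V≤h
      decoded : ∀ {A} → ∣ A ∣ ≡ h × EYes A → A ∈ map Yes.decode (words Yes.slotWeights h)
      decoded {A} (size , yes-event) = subst (_∈ map Yes.decode (words Yes.slotWeights h)) (Yes.decode-encode A consistent)
        (∈.∈-map⁺ Yes.decode (words-complete Yes.slotWeights h (Yes.encode A) (len , wt)))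
        where
        consistent = EYes⇒Consistent A yes-event
        len : length (Yes.encode A) ≡ length Yes.slotWeights
        len = trans (length-map (bit A) slots) (sym Yes.length-slotWeights)
        wt : weight Yes.slotWeights (Yes.encode A) ≡ h
        wt = trans (sym (Yes.∣decode∣ (Yes.encode A) (length-map (bit A) slots))) (trans (cong ∣_∣ (Yes.decode-encode A consistent)) size)


  ratio-of-counts : ∀ m c → c IsHalfOf length free → #V ≤ n / 2 →
    suc (suc m) * (2 * imbalance blocks + 8) ≤ c → CountRatio≤ EYes ENo (suc (suc m)) (suc m)
  ratio-of-counts m c c-half #V≤h flat Ly unique sound =
    Ln , proj₁ (proj₂ no-family) , proj₁ (proj₂ (proj₂ no-family)) , inequality
    where
    open ≤-Reasoning
    h = n / 2
    M = length free
    no-family = no-sets h #V≤h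
    Ln = proj₁ no-family
    h-half : h IsHalfOf (M + total blocks)
    h-half = subst (h IsHalfOf_) (trans (sym #V+#free≡n) (trans (+-comm #V M) (cong (M +_) (sym total-No-blockWeights)))) (/2-IsHalfOf n)
    inequality : suc m * length Ly ≤ suc (suc m) * length Ln
    inequality = begin
      suc m * length Ly
        ≤⟨ *-monoʳ-≤ (suc m) (yes-sets-length≤ h #V≤h Ly unique sound) ⟩
      suc m * sum (map (λ y → M C (h ∸ y)) (choiceSums (unsplit blocks)))
        ≤⟨ choiceSums-ratio m M c h blocks c-half h-half (subst (_≤ h) (sym total-No-blockWeights) #V≤h) flat ⟩
      suc (suc m) * sum (map (λ y → M C (h ∸ y)) (choiceSums blocks))
        ≡⟨ cong (suc (suc m) *_) (proj₂ (proj₂ (proj₂ no-family))) ⟨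
      suc (suc m) * length Ln ∎

-- S vertices occupied by at most F ≤ n / L⁴ responses leave a sparse configuration:
-- most of [n] is free, and the imbalance D ≤ L S is negligible against n.
module Sparse (m L n S F M D : ℕ)
  (L-large : 64 * suc (suc m) ≤ L) (n-large : 128 * suc (suc m) ≤ n)
  (few-responses : F * L ^ 4 ≤ n) (S≤2F : S ≤ 2 * F) (D≤LS : D ≤ L * S) (S+M≡n : S + M ≡ n) where

  private
    m2 = suc (suc m)
    L³ = L * (L * L)

    2≤L : 2 ≤ L
    2≤L = ≤-trans (s≤s (s≤s z≤n)) L-large

    L≤L³ : L ≤ L³
    L≤L³ = m≤m*n L (L * L) {{>-nonZero (*-mono-≤ (≤-trans (s≤s z≤n) 2≤L) (≤-trans (s≤s z≤n) 2≤L))}}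

    SL⁴≤2n : S * L ^ 4 ≤ 2 * n
    SL⁴≤2n = begin
      S * L ^ 4        ≤⟨ *-monoˡ-≤ (L ^ 4) S≤2F ⟩
      2 * F * L ^ 4    ≡⟨ *-assoc 2 F (L ^ 4) ⟩
      2 * (F * L ^ 4)  ≤⟨ *-monoʳ-≤ 2 few-responses ⟩
      2 * n            ∎
      where open ≤-Reasoning

    8S≤n : 8 * S ≤ n
    8S≤n = *-cancelˡ-≤ 2 (begin
      2 * (8 * S)      ≡⟨ sixteen S ⟩
      S * 2 ^ 4        ≤⟨ *-monoʳ-≤ S (^-monoˡ-≤ 4 2≤L) ⟩
      S * L ^ 4        ≤⟨ SL⁴≤2n ⟩
      2 * n            ∎)
      where
      open ≤-Reasoning
      sixteen : ∀ S → 2 * (8 * S) ≡ S * 16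
      sixteen = solve-∀

    32LS≤n : 32 * m2 * (L * S) ≤ n
    32LS≤n = *-cancelʳ-≤ _ _ L³ {{>-nonZero (≤-trans (s≤s z≤n) (≤-trans 2≤L L≤L³))}} (begin
      32 * m2 * (L * S) * L³   ≡⟨ expand m2 L S ⟩
      32 * m2 * (S * L ^ 4)    ≤⟨ *-monoʳ-≤ (32 * m2) SL⁴≤2n ⟩
      32 * m2 * (2 * n)        ≡⟨ double m2 n ⟩
      64 * m2 * n              ≤⟨ *-monoˡ-≤ n (≤-trans L-large L≤L³) ⟩
      L³ * n                   ≡⟨ *-comm L³ n ⟩
      n * L³                   ∎)
      where
      open ≤-Reasoning
      expand : ∀ m2 L S → 32 * m2 * (L * S) * (L * (L * L)) ≡ 32 * m2 * (S * (L * (L * (L * (L * 1)))))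
      expand = solve-∀
      double : ∀ m2 n → 32 * m2 * (2 * n) ≡ 64 * m2 * n
      double = solve-∀

  S≤n/2 : S ≤ n / 2
  S≤n/2 = m*2≤n⇒m≤n/2 {n = n} (≤-trans (*-monoʳ-≤ S (s≤s (s≤s z≤n))) (≤-trans (≤-reflexive (*-comm S 8)) 8S≤n))

  flat : m2 * (2 * D + 8) ≤ M / 2
  flat = m*2≤n⇒m≤n/2 {n = M} (*-cancelˡ-≤ 8 (begin
      8 * (m2 * (2 * D + 8) * 2)            ≡⟨ expand m2 D ⟩
      32 * m2 * D + 128 * m2                ≤⟨ +-mono-≤ (*-monoʳ-≤ (32 * m2) D≤LS) n-large ⟩
      32 * m2 * (L * S) + n                 ≤⟨ +-monoˡ-≤ n 32LS≤n ⟩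
      n + n                                 ≤⟨ +-monoʳ-≤ n (m≤m+n n (5 * n)) ⟩
      n + (n + 5 * n)                       ≡⟨ seven n ⟩
      7 * n + 0                             ≤⟨ +-monoˡ-≤ 0 7n≤8M ⟩
      8 * M + 0                             ≡⟨ +-identityʳ (8 * M) ⟩
      8 * M                                 ∎))
    where
    open ≤-Reasoning
    expand : ∀ m2 D → 8 * (m2 * (2 * D + 8) * 2) ≡ 32 * m2 * D + 128 * m2
    expand = solve-∀
    seven : ∀ n → n + (n + 5 * n) ≡ 7 * n + 0
    seven = solve-∀
    7n≤8M : 7 * n ≤ 8 * M
    7n≤8M = +-cancelˡ-≤ n _ _ (begin
      n + 7 * n          ≡⟨ cong (λ z → z + 7 * z) S+M≡n ⟨
      (S + M) + 7 * (S + M) ≡⟨ distribute S M ⟩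
      8 * S + 8 * M      ≤⟨ +-monoˡ-≤ (8 * M) 8S≤n ⟩
      n + 8 * M          ∎)
      where
      distribute : ∀ S M → (S + M) + 7 * (S + M) ≡ 8 * S + 8 * M
      distribute = solve-∀

lemma6p2 : ∀ (m : ℕ) → ∃[ N ] (∀ (n : ℕ) → N ≤ n → ∀ (t : ℕ) (v : Fin t → Resp n) →
    Graph.ET v → Graph.EF v →
    CountRatio≤ (Graph.EYes v) (Graph.ENo v) (suc (suc m)) (suc m))
lemma6p2 m = 2 ^ (64 * m2) + 128 * m2 , λ n N≤n t v (_ , _ , small-components) few-responses →
  let open Components v
      L = ⌊log₂ n ⌋
      L-large : 64 * m2 ≤ L
      L-large = subst (_≤ L) (⌊log₂[2^n]⌋≡n (64 * m2)) (⌊log₂⌋-mono-≤ (≤-trans (m≤m+n _ (128 * m2)) N≤n))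
      open Sparse m L n #V (Graph.numNonEmpty v) (length free) (imbalance blocks)
        L-large (≤-trans (m≤n+m _ (2 ^ (64 * m2))) N≤n) few-responses #V≤2*numNonEmpty
        (imbalance-≤ L small-components) #V+#free≡n
  in ratio-of-counts m (length free / 2) (/2-IsHalfOf (length free)) S≤n/2 flat
  where
  m2 = suc (suc m)
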